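{- Let $K$ be a real quadratic field. Up to equivalence there is a unique good basis of $\mathcal{O}_K$ of the form $\{1,y\}$. Such a basis is given by $y=b+\omega$ with $b=\lfloor\beta\rfloor$, where $$\beta=\frac{1-\mathrm{Tr}(\omega)-\sqrt{\Delta_K-3}}{2}.$$ The minimal angle $\theta$ of the resulting well-rounded twist of $\Lambda_K$ satisfies $$\cos\theta=\begin{cases}\dfrac{b^2+b+(5-D)/4}{2b+1}, & D\equiv1\pmod4,\\[2mm] \dfrac{b^2+1-D}{2b}, & D\not\equiv1\pmod 4.\end{cases}$$
   Context: $K=\mathbb{Q}(\sqrt D)\subset\mathbb{R}$, $D>1$ square-free; $\omega=(1+\sqrt D)/2$ if $D\equiv1\pmod4$ and $\omega=\sqrt D$ otherwise, so $\mathcal{O}_K=\mathbb{Z}[\omega]$; $\bar x$ the Galois conjugate, $N(x)=x\bar x$, $\mathrm{Tr}(x)=x+\bar x$, $\Delta_K$ the discriminant. $\Lambda_K=\{(x,\bar x):x\in\mathcal{O}_K\}$, $T_\alpha=\mathrm{diag}(\alpha,1/\alpha)$. A basis $\{u,v\}$ of a planar lattice is minimal if $\|u\|=\|v\|$ and $|\langle u,v\rangle|\le\frac12\|u\|\|v\|$. A $\mathbb{Z}$-basis $\{x,y\}$ of $\mathcal{O}_K$ is good if for some $\alpha>0$, $T_\alpha\Lambda_K$ is well-rounded with minimal basis $\{T_\alpha(x,\bar x),T_\alpha(y,\bar y)\}$; $\theta$ is then the angle between these two vectors. Two bases are equivalent if they have the same value of $F(x,y)=N(x)^2+N(x)N(y)+N(y)^2-\Delta_K/4$.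 -}

module Defs where

open import Data.Nat as ℕ using (ℕ)
open import Data.Nat.Divisibility using (_∣_)
open import Data.Bool using (Bool; true; false; if_then_else_)
open import Data.Integer as ℤ using (ℤ; +_)
open import Data.Rational as ℚ using (ℚ; 0ℚ; 1ℚ; ½; _/_)
open import Data.Product using (_×_; _,_; ∃)
open import Data.Sum using (_⊎_)
open import Relation.Binary.PropositionalEquality using (_≡_)

SquareFree : ℕ → Set
SquareFree n = ∀ m → m ℕ.* m ∣ n → m ≡ 1

module QuadField (D : ℕ) where

  Dℚ : ℚ
  Dℚ = + D / 1

  D≡1mod4? : Bool
  D≡1mod4? = (D ℕ.% 4) ℕ.≡ᵇ 1

  -- K = ℚ(√D) ⊂ ℝ : the element  re + im·√D  (the real embedding is √D > 0)
  record K : Set where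
    constructor _+_√D
    field
      re : ℚ
      im : ℚ
  open K public

  fromℚ : ℚ → K
  fromℚ q = q + 0ℚ √D

  0K 1K : K
  0K = fromℚ 0ℚ
  1K = fromℚ 1ℚ

  infixl 6 _⊕_ _⊖_
  infixl 7 _⊗_
  infix 8 ⊝_
  infix 4 _<K_ _≤K_

  _⊕_ : K → K → K
  (a + b √D) ⊕ (c + d √D) = (a ℚ.+ c) + (b ℚ.+ d) √D

  ⊝_ : K → K
  ⊝ (a + b √D) = (ℚ.- a) + (ℚ.- b) √D

  _⊖_ : K → K → K
  x ⊖ y = x ⊕ (⊝ y)

  _⊗_ : K → K → K
  (a + b √D) ⊗ (c + d √D) = (a ℚ.* c ℚ.+ b ℚ.* d ℚ.* Dℚ) + (a ℚ.* d ℚ.+ b ℚ.* c) √D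

  conj : K → K
  conj (a + b √D) = a + (ℚ.- b) √D

  N : K → ℚ
  N x = re (x ⊗ conj x)

  Tr : K → ℚ
  Tr x = re (x ⊕ conj x)

  -- The order of K induced by the real embedding (√D the positive root):
  -- p + q√D > 0 written out by cases on the signs of p and q.
  Positive : K → Set
  Positive (p + q √D) =
      (0ℚ ℚ.< p × 0ℚ ℚ.≤ q)
    ⊎ (0ℚ ℚ.≤ p × 0ℚ ℚ.< q)
    ⊎ (0ℚ ℚ.< p × q ℚ.< 0ℚ × q ℚ.* q ℚ.* Dℚ ℚ.< p ℚ.* p)
    ⊎ (p ℚ.< 0ℚ × 0ℚ ℚ.< q × p ℚ.* p ℚ.< q ℚ.* q ℚ.* Dℚ)

  _<K_ : K → K → Set
  x <K y = Positive (y ⊖ x)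

  _≤K_ : K → K → Set
  x ≤K y = (x ≡ y) ⊎ (x <K y)

  AbsLe : K → K → Set
  AbsLe a c = (⊝ c ≤K a) × (a ≤K c)

  ω : K
  ω = if D≡1mod4? then (½ + ½ √D) else (0ℚ + 1ℚ √D)

  Δ : ℤ
  Δ = if D≡1mod4? then + D else + (4 ℕ.* D)

  -- elements of O_K, written in the ℤ-basis {1, ω}: (m , n) ↦ m + nω
  OK : Set
  OK = ℤ × ℤ

  emb : OK → K
  emb (m , n) = fromℚ (m / 1) ⊕ fromℚ (n / 1) ⊗ ω

  oneOK : OK
  oneOK = (+ 1 , + 0)

  -- {x, y} is a ℤ-basis of O_K = ℤ[ω]  (change-of-basis determinant ±1)
  IsBasis : OK → OK → Set
  IsBasis (a , b) (c , d) = (a ℤ.* d ℤ.- b ℤ.* c ≡ + 1) ⊎ (a ℤ.* d ℤ.- b ℤ.* c ≡ ℤ.- (+ 1))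

  -- Write u = T_α(x,x̄) = (αx, x̄/α), v = T_α(y,ȳ), and s = α⁴ > 0.
  -- Then α²‖u‖² = s x² + x̄²,  α²‖v‖² = s y² + ȳ²,  α²⟨u,v⟩ = s x y + x̄ ȳ.
  -- (Necessarily s ∈ K, since ‖u‖ = ‖v‖ forces s (x² − y²) = ȳ² − x̄² with x² ≠ y².)
  normSq·α² : K → K → K
  normSq·α² s x = s ⊗ x ⊗ x ⊕ conj x ⊗ conj x

  inner·α² : K → K → K → K
  inner·α² s x y = s ⊗ x ⊗ y ⊕ conj x ⊗ conj y

  -- {u, v} is a minimal basis of T_α Λ_K (α = s^{1/4}):
  --   ‖u‖ = ‖v‖  and  |⟨u,v⟩| ≤ ½ ‖u‖ ‖v‖   (multiplied through by α² > 0)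
  MinimalWith : K → K → K → Set
  MinimalWith s x y =
    Positive s
    × normSq·α² s x ≡ normSq·α² s y
    × AbsLe (inner·α² s x y) (fromℚ ½ ⊗ normSq·α² s x)

  Good : OK → OK → Set
  Good x y = IsBasis x y × ∃ λ s → MinimalWith s (emb x) (emb y)

  -- F(x,y) = N(x)² + N(x)N(y) + N(y)² − Δ_K/4 ; equivalence = equal F value
  F : OK → OK → ℚ
  F x y = let nx = N (emb x) ; ny = N (emb y) in
          nx ℚ.* nx ℚ.+ nx ℚ.* ny ℚ.+ ny ℚ.* ny ℚ.- (Δ / 4)

  -- b = ⌊β⌋,  β = (1 − Tr ω − √(Δ_K − 3))/2, i.e.  b ≤ β < b + 1.
  -- With r = 1 − Tr ω − 2b ∈ ℚ and M = Δ_K − 3 ≥ 2, these read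
  --   √M ≤ r   ⇔  0 ≤ r ∧ M ≤ r²,
  --   r − 2 < √M ⇔ r − 2 < 0 ∨ (r − 2)² < M.
  IsFloorβ : ℤ → Set
  IsFloorβ b =
    let r = 1ℚ ℚ.- Tr ω ℚ.- (+ 2 ℤ.* b) / 1
        M = (Δ ℤ.- + 3) / 1
        r₂ = r ℚ.- + 2 / 1 in
    (0ℚ ℚ.≤ r × M ℚ.≤ r ℚ.* r) × (r₂ ℚ.< 0ℚ ⊎ r₂ ℚ.* r₂ ℚ.< M)

{-# OPTIONS --safe #-}
module Submission where

-- For a basis {1, y} of O_K (so y = m ± ω) write T = Tr y and s = α⁴. Expanding (s y + ȳ)(y + ȳ)
-- with ‖u‖ = ‖v‖ gives ⟨u,v⟩ T = ‖u‖² (N y + 1), i.e. cos θ = (N y + 1)/T, and 4(N y + 1) = T² − Δ_K + 4.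
-- So |cos θ| ≤ ½ says √(Δ_K − 3) ∈ [|T| − 1, |T| + 1], while b = ⌊β⌋ says √(Δ_K − 3) ∈ (u₀ − 1, u₀ + 1]
-- for u₀ = −Tr(b + ω). As |T| ≡ u₀ (mod 2), |T| is u₀, or u₀ + 2 when √(Δ_K − 3) = u₀ + 1; either way
-- (T² − Δ_K + 2)², and with it F, is the same. Conversely, for y = b + ω these bounds give |cos θ| ≤ ½,
-- and s = (1 − ȳ²)² / (T² − (N y + 1)²) is a positive solution of ‖u‖ = ‖v‖.

open import Defs
open import Level using (0ℓ)
open import Data.Bool as Bool using (true; false; if_then_else_)
open import Data.Empty using (⊥-elim)
open import Data.Unit using (tt)
open import Data.Maybe as Maybe using (Maybe)
open import Data.Nat as ℕ using (ℕ; zero; suc)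
import Data.Nat.Properties as ℕP
open import Data.Integer as ℤ using (ℤ; +_; -[1+_])
import Data.Integer.Properties as ℤP
import Data.Integer.Tactic.RingSolver as ℤ-Solver
open import Data.Rational as ℚ using (ℚ; 0ℚ; 1ℚ; ½; _/_)
import Data.Rational.Properties as ℚP
import Data.Rational.Unnormalised as ℚᵘ
import Data.Rational.Unnormalised.Properties as ℚᵘP
open import Data.Product using (_×_; _,_; proj₁; proj₂; Σ)
open import Data.Sum using (_⊎_; inj₁; inj₂)
open import Relation.Nullary using (¬_; yes; no)
open import Relation.Nullary.Decidable.Core using (dec⇒maybe)
open import Relation.Binary.Definitions using (tri<; tri≈; tri>)
open import Relation.Binary.PropositionalEquality
open import Algebra.Bundles using (CommutativeRing; RawRing)
open import Algebra.Structures using (IsCommutativeRing)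
import Algebra.Solver.Ring.AlmostCommutativeRing as ACR
import Tactic.RingSolver as RS
import Tactic.RingSolver.Core.AlmostCommutativeRing as TACR

module RationalFacts where
  open import Data.Rational using (_<_; _≤_; _+_; _*_; _-_; -_)

  ℚ-ring : TACR.AlmostCommutativeRing 0ℓ 0ℓ
  ℚ-ring = TACR.fromCommutativeRing ℚP.+-*-commutativeRing (λ x → dec⇒maybe (0ℚ ℚP.≟ x))

  private
    move : ∀ a b → a + (b - a) ≡ b
    move = RS.solve-∀ ℚ-ring

  neg-involutive : ∀ p → - (- p) ≡ p
  neg-involutive = RS.solve-∀ ℚ-ring

  0<q-p⇒p<q : ∀ {p q} → 0ℚ < q - p → p < q
  0<q-p⇒p<q {p} {q} h = subst₂ _<_ (ℚP.+-identityʳ p) (move p q) (ℚP.+-monoʳ-< p h)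

  0≤q-p⇒p≤q : ∀ {p q} → 0ℚ ≤ q - p → p ≤ q
  0≤q-p⇒p≤q {p} {q} h = subst₂ _≤_ (ℚP.+-identityʳ p) (move p q) (ℚP.+-monoʳ-≤ p h)

  p<0⇒0<-p : ∀ {p} → p < 0ℚ → 0ℚ < - p
  p<0⇒0<-p {p} = ℚP.neg-antimono-< {p} {0ℚ}

  0<-p⇒p<0 : ∀ {p} → 0ℚ < - p → p < 0ℚ
  0<-p⇒p<0 {p} h = subst (_< 0ℚ) (neg-involutive p) (ℚP.neg-antimono-< h)

  0≤-p⇒p≤0 : ∀ {p} → 0ℚ ≤ - p → p ≤ 0ℚ
  0≤-p⇒p≤0 {p} h = subst (_≤ 0ℚ) (neg-involutive p) (ℚP.neg-antimono-≤ h)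

  pos*pos>0 : ∀ {p q} → 0ℚ < p → 0ℚ < q → 0ℚ < p * q
  pos*pos>0 {p} {q} hp hq = subst (_< p * q) (ℚP.*-zeroˡ q) (ℚP.*-monoˡ-<-pos q {{ℚ.positive hq}} hp)

  nonNeg*nonNeg≥0 : ∀ {p q} → 0ℚ ≤ p → 0ℚ ≤ q → 0ℚ ≤ p * q
  nonNeg*nonNeg≥0 {p} {q} hp hq =
    subst (_≤ p * q) (ℚP.*-zeroˡ q) (ℚP.*-monoʳ-≤-nonNeg q {{ℚ.nonNegative hq}} hp)

  pos+pos>0 : ∀ {p q} → 0ℚ < p → 0ℚ < q → 0ℚ < p + q
  pos+pos>0 {p} {q} p>0 q>0 = subst (_< p + q) (ℚP.+-identityʳ 0ℚ) (ℚP.+-mono-< p>0 q>0)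

  nonNeg+pos>0 : ∀ {p q} → 0ℚ ≤ p → 0ℚ < q → 0ℚ < p + q
  nonNeg+pos>0 {p} {q} p≥0 q>0 = subst (_< p + q) (ℚP.+-identityʳ 0ℚ) (ℚP.+-mono-≤-< p≥0 q>0)

  neg*neg>0 : ∀ {p q} → p < 0ℚ → q < 0ℚ → 0ℚ < p * q
  neg*neg>0 {p} {q} hp hq = subst (0ℚ <_) (negate² p q) (pos*pos>0 (p<0⇒0<-p hp) (p<0⇒0<-p hq))
    where negate² : ∀ p q → - p * - q ≡ p * q
          negate² = RS.solve-∀ ℚ-ring

  pos*neg<0 : ∀ {p q} → 0ℚ < p → q < 0ℚ → p * q < 0ℚ
  pos*neg<0 {p} {q} hp hq = 0<-p⇒p<0 (subst (0ℚ <_) (*-neg p q) (pos*pos>0 hp (p<0⇒0<-p hq)))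
    where *-neg : ∀ p q → p * - q ≡ - (p * q)
          *-neg = RS.solve-∀ ℚ-ring

  square>0 : ∀ {p} → ¬ p ≡ 0ℚ → 0ℚ < p * p
  square>0 {p} p≢0 with ℚP.<-cmp p 0ℚ
  ... | tri< p<0 _ _ = neg*neg>0 p<0 p<0
  ... | tri≈ _ p≡0 _ = ⊥-elim (p≢0 p≡0)
  ... | tri> _ _ p>0 = pos*pos>0 p>0 p>0

  square≥0 : ∀ p → 0ℚ ≤ p * p
  square≥0 p with ℚP.<-cmp p 0ℚ
  ... | tri< p<0 _ _ = ℚP.<⇒≤ (neg*neg>0 p<0 p<0)
  ... | tri≈ _ refl _ = ℚP.≤-refl
  ... | tri> _ _ p>0 = ℚP.<⇒≤ (pos*pos>0 p>0 p>0)

  <⇒≱ : ∀ {p q} → p < q → ¬ q ≤ p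
  <⇒≱ p<q q≤p = ℚP.<-irrefl refl (ℚP.<-≤-trans p<q q≤p)

  reciprocal : ∀ d → 0ℚ < d → Σ ℚ (λ c → 0ℚ < c × c * d ≡ 1ℚ)
  reciprocal d d>0 = (ℚ.1/ d) {{d≢0}} , ℚP.positive⁻¹ _ {{ℚP.1/pos⇒pos d {{d-pos}}}} , ℚP.*-inverseˡ d {{d≢0}}
    where d-pos = ℚ.positive d>0
          d≢0 = ℚP.pos⇒nonZero d {{d-pos}}

open RationalFacts

module IntegerEmbedding where
  ι : ℤ → ℚ
  ι i = i / 1

  private
    toℚᵘ-ι : ∀ i → ℚ.toℚᵘ (ι i) ℚᵘ.≃ ℚᵘ.mkℚᵘ i 0
    toℚᵘ-ι i = ℚP.toℚᵘ-fromℚᵘ (ℚᵘ.mkℚᵘ i 0)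

  ι-+ : ∀ i j → ι (i ℤ.+ j) ≡ ι i ℚ.+ ι j
  ι-+ i j = ℚP.toℚᵘ-injective (ℚᵘP.≃-trans (toℚᵘ-ι (i ℤ.+ j)) (ℚᵘP.≃-trans (ℚᵘ.*≡* (cross i j))
     (ℚᵘP.≃-sym (ℚᵘP.≃-trans (ℚP.toℚᵘ-homo-+ (ι i) (ι j)) (ℚᵘP.+-cong (toℚᵘ-ι i) (toℚᵘ-ι j))))))
    where cross : ∀ i j → (i ℤ.+ j) ℤ.* + 1 ≡ (i ℤ.* + 1 ℤ.+ j ℤ.* + 1) ℤ.* + 1
          cross = ℤ-Solver.solve-∀

  ι-* : ∀ i j → ι (i ℤ.* j) ≡ ι i ℚ.* ι j
  ι-* i j = ℚP.toℚᵘ-injective (ℚᵘP.≃-trans (toℚᵘ-ι (i ℤ.* j)) (ℚᵘP.≃-trans (ℚᵘ.*≡* refl)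
     (ℚᵘP.≃-sym (ℚᵘP.≃-trans (ℚP.toℚᵘ-homo-* (ι i) (ι j)) (ℚᵘP.*-cong (toℚᵘ-ι i) (toℚᵘ-ι j))))))

  ι-neg : ∀ i → ι (ℤ.- i) ≡ ℚ.- ι i
  ι-neg i = ℚP.toℚᵘ-injective (ℚᵘP.≃-trans (toℚᵘ-ι (ℤ.- i))
     (ℚᵘP.≃-sym (ℚᵘP.≃-trans (ℚP.toℚᵘ-homo‿- (ι i)) (ℚᵘP.-‿cong (toℚᵘ-ι i)))))

  ι-- : ∀ i j → ι (i ℤ.- j) ≡ ι i ℚ.- ι j
  ι-- i j = trans (ι-+ i (ℤ.- j)) (cong (ι i ℚ.+_) (ι-neg j))

  ι-cancel-≤ : ∀ {i j} → ι i ℚ.≤ ι j → i ℤ.≤ j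
  ι-cancel-≤ {i} {j} p with ℚᵘP.≤-respʳ-≃ (toℚᵘ-ι j) (ℚᵘP.≤-respˡ-≃ (toℚᵘ-ι i) (ℚP.toℚᵘ-mono-≤ p))
  ... | ℚᵘ.*≤* q = subst₂ ℤ._≤_ (ℤP.*-identityʳ i) (ℤP.*-identityʳ j) q

  ι-mono-≤ : ∀ {i j} → i ℤ.≤ j → ι i ℚ.≤ ι j
  ι-mono-≤ {i} {j} p = ℚP.toℚᵘ-cancel-≤ (ℚᵘP.≤-respʳ-≃ (ℚᵘP.≃-sym (toℚᵘ-ι j))
     (ℚᵘP.≤-respˡ-≃ (ℚᵘP.≃-sym (toℚᵘ-ι i))
       (ℚᵘ.*≤* (subst₂ ℤ._≤_ (sym (ℤP.*-identityʳ i)) (sym (ℤP.*-identityʳ j)) p))))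

  ι-cancel-< : ∀ {i j} → ι i ℚ.< ι j → i ℤ.< j
  ι-cancel-< {i} {j} p with ℚᵘP.<-respʳ-≃ (toℚᵘ-ι j) (ℚᵘP.<-respˡ-≃ (toℚᵘ-ι i) (ℚP.toℚᵘ-mono-< p))
  ... | ℚᵘ.*<* q = subst₂ ℤ._<_ (ℤP.*-identityʳ i) (ℤP.*-identityʳ j) q

  ι-mono-< : ∀ {i j} → i ℤ.< j → ι i ℚ.< ι j
  ι-mono-< {i} {j} p = ℚP.toℚᵘ-cancel-< (ℚᵘP.<-respʳ-≃ (ℚᵘP.≃-sym (toℚᵘ-ι j))
     (ℚᵘP.<-respˡ-≃ (ℚᵘP.≃-sym (toℚᵘ-ι i))
       (ℚᵘ.*<* (subst₂ ℤ._<_ (sym (ℤP.*-identityʳ i)) (sym (ℤP.*-identityʳ j)) p))))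

  i/4≡ι[i]*¼ : ∀ i → i / 4 ≡ ι i ℚ.* (+ 1 / 4)
  i/4≡ι[i]*¼ i = ℚP.toℚᵘ-injective (ℚᵘP.≃-trans (ℚP.toℚᵘ-fromℚᵘ (ℚᵘ.mkℚᵘ i 3))
     (ℚᵘP.≃-sym (ℚᵘP.≃-trans (ℚP.toℚᵘ-homo-* (ι i) (+ 1 / 4))
       (ℚᵘP.≃-trans (ℚᵘP.*-cong (toℚᵘ-ι i) ℚᵘP.≃-refl) (ℚᵘ.*≡* (cross i))))))
    where cross : ∀ i → i ℤ.* + 1 ℤ.* + 4 ≡ i ℤ.* + 4
          cross = ℤ-Solver.solve-∀

open IntegerEmbedding

module IntegerWindow where
  open import Data.Integer using (_+_; _*_; _-_; -_; _≤_; _<_)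

  -- √M ≤ r  and  r < √M, stated without square roots
  SqrtAtMost : ℤ → ℤ → Set
  SqrtAtMost M r = + 0 ≤ r × M ≤ r * r

  BelowSqrt : ℤ → ℤ → Set
  BelowSqrt r M = r < + 0 ⊎ r * r < M

  InWindow : ℤ → ℤ → Set
  InWindow M u = + 0 ≤ u × (u - + 1) * (u - + 1) ≤ M × M ≤ (u + + 1) * (u + + 1)

  0≤i+j : ∀ {i j} → + 0 ≤ i → + 0 ≤ j → + 0 ≤ i + j
  0≤i+j = ℤP.+-mono-≤

  0≤i*j : ∀ {i j} → + 0 ≤ i → + 0 ≤ j → + 0 ≤ i * j
  0≤i*j {i} {j} 0≤i 0≤j = subst (+ 0 ≤_) (cong₂ _*_ (ℤP.0≤i⇒+∣i∣≡i 0≤i) (ℤP.0≤i⇒+∣i∣≡i 0≤j))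
    (subst (+ 0 ≤_) (ℤP.pos-* ℤ.∣ i ∣ ℤ.∣ j ∣) (ℤ.+≤+ ℕ.z≤n))

  0≤+ : ∀ n → + 0 ≤ + n
  0≤+ n = ℤ.+≤+ ℕ.z≤n

  i<j⇒0≤j-i-1 : ∀ {i j} → i < j → + 0 ≤ j - i - + 1
  i<j⇒0≤j-i-1 {i} {j} i<j = subst (+ 0 ≤_) (shift i j) (ℤP.i≤j⇒0≤j-i (ℤP.i<j⇒suc[i]≤j i<j))
    where shift : ∀ i j → j - (+ 1 + i) ≡ j - i - + 1
          shift = ℤ-Solver.solve-∀

  0≤j-i-1⇒i<j : ∀ {i j} → + 0 ≤ j - i - + 1 → i < j
  0≤j-i-1⇒i<j {i} {j} h = ℤP.suc[i]≤j⇒i<j (ℤP.0≤i-j⇒j≤i (subst (+ 0 ≤_) (sym (shift i j)) h))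
    where shift : ∀ i j → j - (+ 1 + i) ≡ j - i - + 1
          shift = ℤ-Solver.solve-∀

  -- The contradictions below write −1 as a sum of non-negative terms.
  0≤i⇒i≢-1 : ∀ {i} → + 0 ≤ i → ¬ i ≡ -[1+ 0 ]
  0≤i⇒i≢-1 () refl

  window-offset : ∀ M T j → SqrtAtMost M (T + + 1) → BelowSqrt (T - + 1) M →
                  InWindow M (T + + 2 * j) → j ≡ + 0 ⊎ (j ≡ + 1 × M ≡ (T + + 1) * (T + + 1))
  window-offset M T (+ zero) _ _ _ = inj₁ refl
  window-offset M T (+ suc zero) (_ , M≤) _ (_ , ≤M , _) =
    inj₂ (refl , ℤP.≤-antisym M≤ (subst (λ z → z * z ≤ M) (T+2-1 T) ≤M))
    where T+2-1 : ∀ T → T + + 2 * + 1 - + 1 ≡ T + + 1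
          T+2-1 = ℤ-Solver.solve-∀
  window-offset M T (+ suc (suc k)) (0≤T+1 , M≤) _ (_ , ≤M , _) = ⊥-elim (0≤i⇒i≢-1 sum (identity T M (+ k)))
    where
      ≤M' = subst (λ j → (T + + 2 * j - + 1) * (T + + 2 * j - + 1) ≤ M) (cong +_ (ℕP.+-comm 2 k)) ≤M
      sum = 0≤i+j (0≤i+j (ℤP.i≤j⇒0≤j-i ≤M') (ℤP.i≤j⇒0≤j-i M≤))
              (0≤i+j (0≤i+j (0≤i+j (0≤i*j (0≤i*j (0≤+ 4) (0≤i+j (0≤+ k) (0≤+ 1))) 0≤T+1)
                                   (0≤i*j (0≤i*j (0≤+ 4) (0≤+ k)) (0≤+ k)))
                            (0≤i*j (0≤+ 8) (0≤+ k))) (0≤+ 3))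
      identity : ∀ T M K → (M - (T + + 2 * (K + + 2) - + 1) * (T + + 2 * (K + + 2) - + 1))
               + ((T + + 1) * (T + + 1) - M)
               + (+ 4 * (K + + 1) * (T + + 1) + + 4 * K * K + + 8 * K + + 3) ≡ -[1+ 0 ]
      identity = ℤ-Solver.solve-∀
  window-offset M T -[1+ k ] _ (inj₁ T-1<0) (0≤u , _) =
    ⊥-elim (0≤i⇒i≢-1 (0≤i+j (0≤i+j (0≤i+j (i<j⇒0≤j-i-1 T-1<0) 0≤u') (0≤i*j (0≤+ 2) (0≤+ k))) (0≤+ 1))
                     (identity T (+ k)))
    where
      0≤u' = subst (λ j → + 0 ≤ T + + 2 * j) (cong (λ z → - (+ z)) (sym (ℕP.+-comm k 1))) 0≤u
      identity : ∀ T K → + 0 - (T - + 1) - + 1 + (T + + 2 * (- (K + + 1))) + + 2 * K + + 1 ≡ -[1+ 0 ]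
      identity = ℤ-Solver.solve-∀
  window-offset M T -[1+ k ] _ (inj₂ [T-1]²<M) (0≤u , _ , M≤) =
    ⊥-elim (0≤i⇒i≢-1 (0≤i+j (0≤i+j (i<j⇒0≤j-i-1 [T-1]²<M) (ℤP.i≤j⇒0≤j-i M≤'))
                           (0≤i*j (0≤i*j (0≤+ 4) (0≤+ k)) (0≤i+j (0≤i+j 0≤u' (0≤+ k)) (0≤+ 1))))
                     (identity T M (+ k)))
    where
      k+1≡1+k = cong (λ z → - (+ z)) (sym (ℕP.+-comm k 1))
      0≤u' = subst (λ j → + 0 ≤ T + + 2 * j) k+1≡1+k 0≤u
      M≤' = subst (λ j → M ≤ (T + + 2 * j + + 1) * (T + + 2 * j + + 1)) k+1≡1+k M≤
      identity : ∀ T M K → (M - (T - + 1) * (T - + 1) - + 1)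
             + ((T + + 2 * (- (K + + 1)) + + 1) * (T + + 2 * (- (K + + 1)) + + 1) - M)
             + (+ 4 * K) * ((T + + 2 * (- (K + + 1))) + K + + 1) ≡ -[1+ 0 ]
      identity = ℤ-Solver.solve-∀

  window-defect² : ∀ M T j → SqrtAtMost M (T + + 1) → BelowSqrt (T - + 1) M →
                   let u = T + + 2 * j in InWindow M u →
                   (u * u - M - + 1) * (u * u - M - + 1) ≡ (T * T - M - + 1) * (T * T - M - + 1)
  window-defect² M T j √M≤T+1 T-1<√M u∈W with window-offset M T j √M≤T+1 T-1<√M u∈W
  ... | inj₁ refl = cong (λ z → (z * z - M - + 1) * (z * z - M - + 1)) (ℤP.+-identityʳ T)
  ... | inj₂ (refl , refl) = expand T
    where expand : ∀ T → let u = T + + 2 * + 1 ; M = (T + + 1) * (T + + 1) in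
                   (u * u - M - + 1) * (u * u - M - + 1) ≡ (T * T - M - + 1) * (T * T - M - + 1)
          expand = ℤ-Solver.solve-∀

  window-lower : ∀ M u → + 2 ≤ M → SqrtAtMost M (u + + 1) → BelowSqrt (u - + 1) M →
                 + 0 ≤ u - + 1 × + 0 ≤ M - (u - + 1) * (u - + 1) - + 1
  window-lower M u 2≤M (0≤u+1 , M≤) u-1<√M = 0≤u-1 , strict u-1<√M
    where
      0≤u-1 : + 0 ≤ u - + 1
      0≤u-1 with u + + 1 ℤP.<? + 2
      ... | yes lt = ⊥-elim (0≤i⇒i≢-1 (0≤i+j (0≤i+j (0≤i+j (ℤP.i≤j⇒0≤j-i M≤) (ℤP.i≤j⇒0≤j-i 2≤M))
                                               (0≤i*j 0≤u+1 (i<j⇒0≤j-i-1 lt))) (i<j⇒0≤j-i-1 lt))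
                                      (identity (u + + 1) M))
        where identity : ∀ R M → (R * R - M) + (M - + 2) + R * (+ 2 - R - + 1) + (+ 2 - R - + 1) ≡ -[1+ 0 ]
              identity = ℤ-Solver.solve-∀
      ... | no ≮ = subst (+ 0 ≤_) (shift u) (ℤP.i≤j⇒0≤j-i (ℤP.≮⇒≥ ≮))
        where shift : ∀ u → u + + 1 - + 2 ≡ u - + 1
              shift = ℤ-Solver.solve-∀
      strict : BelowSqrt (u - + 1) M → + 0 ≤ M - (u - + 1) * (u - + 1) - + 1
      strict (inj₁ u-1<0) = ⊥-elim (0≤i⇒i≢-1 (0≤i+j (i<j⇒0≤j-i-1 u-1<0) 0≤u-1) (identity u))
        where identity : ∀ u → (+ 0 - (u - + 1) - + 1) + (u - + 1) ≡ -[1+ 0 ]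
              identity = ℤ-Solver.solve-∀
      strict (inj₂ lt) = i<j⇒0≤j-i-1 lt

open IntegerWindow

1<D⇒1[mod4]⇒5≤D : ∀ D → 1 ℕ.< D → QuadField.D≡1mod4? D ≡ true → 5 ℕ.≤ D
1<D⇒1[mod4]⇒5≤D 1 (ℕ.s≤s ()) _
1<D⇒1[mod4]⇒5≤D 2 _ ()
1<D⇒1[mod4]⇒5≤D 3 _ ()
1<D⇒1[mod4]⇒5≤D 4 _ ()
1<D⇒1[mod4]⇒5≤D (suc (suc (suc (suc (suc _))))) _ _ = ℕ.s≤s (ℕ.s≤s (ℕ.s≤s (ℕ.s≤s (ℕ.s≤s ℕ.z≤n))))

module RealQuadratic (D : ℕ) where
  open import Data.Rational using (_<_; _≤_; _+_; _*_; _-_; -_)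
  open QuadField D renaming (_+_√D to _⟨_⟩)

  private
    ⊗-assoc-re : ∀ a b c d e f g → (a * c + b * d * g) * e + (a * d + b * c) * f * g
                                   ≡ a * (c * e + d * f * g) + b * (c * f + d * e) * g
    ⊗-assoc-re = RS.solve-∀ ℚ-ring
    ⊗-assoc-im : ∀ a b c d e f g → (a * c + b * d * g) * f + (a * d + b * c) * e
                                   ≡ a * (c * f + d * e) + b * (c * e + d * f * g)
    ⊗-assoc-im = RS.solve-∀ ℚ-ring
    ⊗-comm-re : ∀ a b c d g → a * c + b * d * g ≡ c * a + d * b * g
    ⊗-comm-re = RS.solve-∀ ℚ-ring
    ⊗-comm-im : ∀ a b c d → a * d + b * c ≡ c * b + d * a
    ⊗-comm-im = RS.solve-∀ ℚ-ring
    ⊗-identity-re : ∀ a b g → 1ℚ * a + 0ℚ * b * g ≡ a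
    ⊗-identity-re = RS.solve-∀ ℚ-ring
    ⊗-identity-im : ∀ a b → 1ℚ * b + 0ℚ * a ≡ b
    ⊗-identity-im = RS.solve-∀ ℚ-ring
    distrib-re : ∀ a b c d e f g → a * (c + e) + b * (d + f) * g
                                   ≡ (a * c + b * d * g) + (a * e + b * f * g)
    distrib-re = RS.solve-∀ ℚ-ring
    distrib-im : ∀ a b c d e f → a * (d + f) + b * (c + e) ≡ (a * d + b * c) + (a * f + b * e)
    distrib-im = RS.solve-∀ ℚ-ring

  ⊗-assoc : ∀ x y z → (x ⊗ y) ⊗ z ≡ x ⊗ (y ⊗ z)
  ⊗-assoc (a ⟨ b ⟩) (c ⟨ d ⟩) (e ⟨ f ⟩) = cong₂ _⟨_⟩ (⊗-assoc-re a b c d e f Dℚ) (⊗-assoc-im a b c d e f Dℚ)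

  ⊗-comm : ∀ x y → x ⊗ y ≡ y ⊗ x
  ⊗-comm (a ⟨ b ⟩) (c ⟨ d ⟩) = cong₂ _⟨_⟩ (⊗-comm-re a b c d Dℚ) (⊗-comm-im a b c d)

  ⊗-identityˡ : ∀ x → 1K ⊗ x ≡ x
  ⊗-identityˡ (a ⟨ b ⟩) = cong₂ _⟨_⟩ (⊗-identity-re a b Dℚ) (⊗-identity-im a b)

  ⊗-identityʳ : ∀ x → x ⊗ 1K ≡ x
  ⊗-identityʳ x = trans (⊗-comm x 1K) (⊗-identityˡ x)

  ⊗-distribˡ-⊕ : ∀ x y z → x ⊗ (y ⊕ z) ≡ x ⊗ y ⊕ x ⊗ z
  ⊗-distribˡ-⊕ (a ⟨ b ⟩) (c ⟨ d ⟩) (e ⟨ f ⟩) = cong₂ _⟨_⟩ (distrib-re a b c d e f Dℚ) (distrib-im a b c d e f)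

  ⊗-distribʳ-⊕ : ∀ x y z → (y ⊕ z) ⊗ x ≡ y ⊗ x ⊕ z ⊗ x
  ⊗-distribʳ-⊕ x y z = begin
    (y ⊕ z) ⊗ x        ≡⟨ ⊗-comm (y ⊕ z) x ⟩
    x ⊗ (y ⊕ z)        ≡⟨ ⊗-distribˡ-⊕ x y z ⟩
    x ⊗ y ⊕ x ⊗ z      ≡⟨ cong₂ _⊕_ (⊗-comm x y) (⊗-comm x z) ⟩
    y ⊗ x ⊕ z ⊗ x      ∎
    where open ≡-Reasoning

  ⊕-assoc : ∀ x y z → (x ⊕ y) ⊕ z ≡ x ⊕ (y ⊕ z)
  ⊕-assoc (a ⟨ b ⟩) (c ⟨ d ⟩) (e ⟨ f ⟩) = cong₂ _⟨_⟩ (ℚP.+-assoc a c e) (ℚP.+-assoc b d f)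

  ⊕-comm : ∀ x y → x ⊕ y ≡ y ⊕ x
  ⊕-comm (a ⟨ b ⟩) (c ⟨ d ⟩) = cong₂ _⟨_⟩ (ℚP.+-comm a c) (ℚP.+-comm b d)

  ⊕-identityˡ : ∀ x → 0K ⊕ x ≡ x
  ⊕-identityˡ (a ⟨ b ⟩) = cong₂ _⟨_⟩ (ℚP.+-identityˡ a) (ℚP.+-identityˡ b)

  ⊕-identityʳ : ∀ x → x ⊕ 0K ≡ x
  ⊕-identityʳ x = trans (⊕-comm x 0K) (⊕-identityˡ x)

  ⊕-inverseˡ : ∀ x → (⊝ x) ⊕ x ≡ 0K
  ⊕-inverseˡ (a ⟨ b ⟩) = cong₂ _⟨_⟩ (ℚP.+-inverseˡ a) (ℚP.+-inverseˡ b)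

  ⊕-inverseʳ : ∀ x → x ⊕ (⊝ x) ≡ 0K
  ⊕-inverseʳ (a ⟨ b ⟩) = cong₂ _⟨_⟩ (ℚP.+-inverseʳ a) (ℚP.+-inverseʳ b)

  K-isCommutativeRing : IsCommutativeRing _≡_ _⊕_ _⊗_ ⊝_ 0K 1K
  K-isCommutativeRing = record
    { isRing = record
      { +-isAbelianGroup = record
        { isGroup = record
          { isMonoid = record
            { isSemigroup = record
              { isMagma = record { isEquivalence = isEquivalence ; ∙-cong = cong₂ _⊕_ }
              ; assoc = ⊕-assoc }
            ; identity = ⊕-identityˡ , ⊕-identityʳ }
          ; inverse = ⊕-inverseˡ , ⊕-inverseʳ
          ; ⁻¹-cong = cong ⊝_ }
        ; comm = ⊕-comm }
      ; *-cong = cong₂ _⊗_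
      ; *-assoc = ⊗-assoc
      ; *-identity = ⊗-identityˡ , ⊗-identityʳ
      ; distrib = ⊗-distribˡ-⊕ , ⊗-distribʳ-⊕ }
    ; *-comm = ⊗-comm }

  K-commutativeRing : CommutativeRing 0ℓ 0ℓ
  K-commutativeRing = record { isCommutativeRing = K-isCommutativeRing }

  κ : ℤ → K
  κ i = fromℚ (ι i)

  fromℚ-⊗ : ∀ p q → fromℚ p ⊗ fromℚ q ≡ fromℚ (p * q)
  fromℚ-⊗ p q = cong₂ _⟨_⟩ (re-part p q Dℚ) (im-part p q)
    where re-part : ∀ p q g → p * q + 0ℚ * 0ℚ * g ≡ p * q
          re-part = RS.solve-∀ ℚ-ring
          im-part : ∀ p q → p * 0ℚ + 0ℚ * q ≡ 0ℚ
          im-part = RS.solve-∀ ℚ-ring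

  κ-+ : ∀ i j → κ (i ℤ.+ j) ≡ κ i ⊕ κ j
  κ-+ i j = cong fromℚ (ι-+ i j)

  κ-* : ∀ i j → κ (i ℤ.* j) ≡ κ i ⊗ κ j
  κ-* i j = trans (cong fromℚ (ι-* i j)) (sym (fromℚ-⊗ (ι i) (ι j)))

  κ-- : ∀ i j → κ (i ℤ.- j) ≡ κ i ⊖ κ j
  κ-- i j = cong fromℚ (ι-- i j)

  private
    K-almostCommutativeRing : ACR.AlmostCommutativeRing 0ℓ 0ℓ
    K-almostCommutativeRing = ACR.fromCommutativeRing K-commutativeRing

    ℤ-rawRing : RawRing 0ℓ 0ℓ
    ℤ-rawRing = CommutativeRing.rawRing ℤP.+-*-commutativeRing

    κ-morphism : ℤ-rawRing ACR.-Raw-AlmostCommutative⟶ K-almostCommutativeRing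
    κ-morphism = record
      { ⟦_⟧ = κ ; +-homo = κ-+ ; *-homo = κ-* ; -‿homo = λ i → cong fromℚ (ι-neg i)
      ; 0-homo = refl ; 1-homo = refl }

    κ-≟ : ∀ i j → Maybe (κ i ≡ κ j)
    κ-≟ i j = Maybe.map (cong κ) (dec⇒maybe (i ℤ.≟ j))

  open import Algebra.Solver.Ring ℤ-rawRing K-almostCommutativeRing κ-morphism κ-≟ public

  0≤Dℚ : 0ℚ ≤ Dℚ
  0≤Dℚ = ι-mono-≤ {+ 0} {+ D} (ℤ.+≤+ ℕ.z≤n)

  fromℚ-⊗-⟨⟩ : ∀ r p q → fromℚ r ⊗ (p ⟨ q ⟩) ≡ (r * p) ⟨ (r * q) ⟩
  fromℚ-⊗-⟨⟩ r p q = cong₂ _⟨_⟩ (re-part r p q Dℚ) (im-part r p q)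
    where re-part : ∀ r p q g → r * p + 0ℚ * q * g ≡ r * p
          re-part = RS.solve-∀ ℚ-ring
          im-part : ∀ r p q → r * q + 0ℚ * p ≡ r * q
          im-part = RS.solve-∀ ℚ-ring

  Positive-scale : ∀ r x → 0ℚ < r → Positive x → Positive (fromℚ r ⊗ x)
  Positive-scale r (p ⟨ q ⟩) r>0 pos = subst Positive (sym (fromℚ-⊗-⟨⟩ r p q)) (scale pos)
    where
      r≥0 = ℚP.<⇒≤ r>0
      sq-re : ∀ r p → (r * p) * (r * p) ≡ (r * r) * (p * p)
      sq-re = RS.solve-∀ ℚ-ring
      sq-im : ∀ r q g → (r * q) * (r * q) * g ≡ (r * r) * (q * q * g)
      sq-im = RS.solve-∀ ℚ-ring
      r²·-mono-< : ∀ {a b} → a < b → (r * r) * a < (r * r) * b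
      r²·-mono-< = ℚP.*-monoʳ-<-pos (r * r) {{ℚ.positive (pos*pos>0 r>0 r>0)}}
      scale : Positive (p ⟨ q ⟩) → Positive ((r * p) ⟨ (r * q) ⟩)
      scale (inj₁ (p>0 , q≥0)) = inj₁ (pos*pos>0 r>0 p>0 , nonNeg*nonNeg≥0 r≥0 q≥0)
      scale (inj₂ (inj₁ (p≥0 , q>0))) = inj₂ (inj₁ (nonNeg*nonNeg≥0 r≥0 p≥0 , pos*pos>0 r>0 q>0))
      scale (inj₂ (inj₂ (inj₁ (p>0 , q<0 , lt)))) =
        inj₂ (inj₂ (inj₁ (pos*pos>0 r>0 p>0 , pos*neg<0 r>0 q<0 ,
          subst₂ _<_ (sym (sq-im r q Dℚ)) (sym (sq-re r p)) (r²·-mono-< lt))))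
      scale (inj₂ (inj₂ (inj₂ (p<0 , q>0 , lt)))) =
        inj₂ (inj₂ (inj₂ (pos*neg<0 r>0 p<0 , pos*pos>0 r>0 q>0 ,
          subst₂ _<_ (sym (sq-re r p)) (sym (sq-im r q Dℚ)) (r²·-mono-< lt))))

  ¬Positive-0K : ¬ Positive 0K
  ¬Positive-0K (inj₁ (0<0 , _)) = ℚP.<-irrefl refl 0<0
  ¬Positive-0K (inj₂ (inj₁ (_ , 0<0))) = ℚP.<-irrefl refl 0<0
  ¬Positive-0K (inj₂ (inj₂ (inj₁ (0<0 , _)))) = ℚP.<-irrefl refl 0<0
  ¬Positive-0K (inj₂ (inj₂ (inj₂ (0<0 , _)))) = ℚP.<-irrefl refl 0<0

  Positive⇒¬Positive-⊝ : ∀ x → Positive x → ¬ Positive (⊝ x)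
  Positive⇒¬Positive-⊝ (p ⟨ q ⟩) = go
    where
      sq : ∀ a → - a * - a ≡ a * a
      sq = RS.solve-∀ ℚ-ring
      sqD : ∀ a → - a * - a * Dℚ ≡ a * a * Dℚ
      sqD a = cong (_* Dℚ) (sq a)
      go : Positive (p ⟨ q ⟩) → ¬ Positive ((- p) ⟨ (- q) ⟩)
      go (inj₁ (p>0 , _)) (inj₁ (-p>0 , _)) = ℚP.<-asym p>0 (0<-p⇒p<0 -p>0)
      go (inj₁ (p>0 , _)) (inj₂ (inj₁ (-p≥0 , _))) = <⇒≱ p>0 (0≤-p⇒p≤0 -p≥0)
      go (inj₁ (p>0 , _)) (inj₂ (inj₂ (inj₁ (-p>0 , _)))) = ℚP.<-asym p>0 (0<-p⇒p<0 -p>0)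
      go (inj₁ (_ , q≥0)) (inj₂ (inj₂ (inj₂ (_ , -q>0 , _)))) = <⇒≱ (0<-p⇒p<0 -q>0) q≥0
      go (inj₂ (inj₁ (p≥0 , _))) (inj₁ (-p>0 , _)) = <⇒≱ (0<-p⇒p<0 -p>0) p≥0
      go (inj₂ (inj₁ (_ , q>0))) (inj₂ (inj₁ (_ , -q>0))) = ℚP.<-asym q>0 (0<-p⇒p<0 -q>0)
      go (inj₂ (inj₁ (p≥0 , _))) (inj₂ (inj₂ (inj₁ (-p>0 , _)))) = <⇒≱ (0<-p⇒p<0 -p>0) p≥0
      go (inj₂ (inj₁ (_ , q>0))) (inj₂ (inj₂ (inj₂ (_ , -q>0 , _)))) = ℚP.<-asym q>0 (0<-p⇒p<0 -q>0)
      go (inj₂ (inj₂ (inj₁ (p>0 , _)))) (inj₁ (-p>0 , _)) = ℚP.<-asym p>0 (0<-p⇒p<0 -p>0)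
      go (inj₂ (inj₂ (inj₁ (p>0 , _)))) (inj₂ (inj₁ (-p≥0 , _))) = <⇒≱ p>0 (0≤-p⇒p≤0 -p≥0)
      go (inj₂ (inj₂ (inj₁ (p>0 , _)))) (inj₂ (inj₂ (inj₁ (-p>0 , _)))) = ℚP.<-asym p>0 (0<-p⇒p<0 -p>0)
      go (inj₂ (inj₂ (inj₁ (_ , _ , lt)))) (inj₂ (inj₂ (inj₂ (_ , _ , lt′)))) =
        ℚP.<-asym lt (subst₂ _<_ (sq p) (sqD q) lt′)
      go (inj₂ (inj₂ (inj₂ (_ , q>0 , _)))) (inj₁ (_ , -q≥0)) = <⇒≱ q>0 (0≤-p⇒p≤0 -q≥0)
      go (inj₂ (inj₂ (inj₂ (_ , q>0 , _)))) (inj₂ (inj₁ (_ , -q>0))) = ℚP.<-asym q>0 (0<-p⇒p<0 -q>0)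
      go (inj₂ (inj₂ (inj₂ (_ , _ , lt)))) (inj₂ (inj₂ (inj₁ (_ , _ , lt′)))) =
        ℚP.<-asym lt (subst₂ _<_ (sqD q) (sq p) lt′)
      go (inj₂ (inj₂ (inj₂ (_ , q>0 , _)))) (inj₂ (inj₂ (inj₂ (_ , -q>0 , _)))) = ℚP.<-asym q>0 (0<-p⇒p<0 -q>0)

  Positive-fromNorm : ∀ p q → 0ℚ < p → q * q * Dℚ < p * p → Positive (p ⟨ q ⟩)
  Positive-fromNorm p q p>0 lt with ℚP.<-cmp q 0ℚ
  ... | tri< q<0 _ _ = inj₂ (inj₂ (inj₁ (p>0 , q<0 , lt)))
  ... | tri≈ _ q≡0 _ = inj₁ (p>0 , ℚP.≤-reflexive (sym q≡0))
  ... | tri> _ _ q>0 = inj₁ (p>0 , ℚP.<⇒≤ q>0)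

  Positive-⊕1K : ∀ s → Positive s → Positive (s ⊕ 1K)
  Positive-⊕1K (p ⟨ q ⟩) pos = subst (λ z → Positive ((p + 1ℚ) ⟨ z ⟩)) (sym (ℚP.+-identityʳ q)) (shift pos)
    where
      p′ = p + 1ℚ
      diff-one : ∀ p → p + 1ℚ - p ≡ 1ℚ
      diff-one = RS.solve-∀ ℚ-ring
      diff-sq-up : ∀ p → (p + 1ℚ) * (p + 1ℚ) - p * p ≡ p + (p + 1ℚ)
      diff-sq-up = RS.solve-∀ ℚ-ring
      diff-sq-down : ∀ p → p * p - (p + 1ℚ) * (p + 1ℚ) ≡ - (p + 1ℚ) + - p
      diff-sq-down = RS.solve-∀ ℚ-ring
      p<p′ : p < p′
      p<p′ = 0<q-p⇒p<q (subst (0ℚ <_) (sym (diff-one p)) (ℚP.positive⁻¹ 1ℚ))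
      sq-grows : 0ℚ < p → p * p < p′ * p′
      sq-grows p>0 = 0<q-p⇒p<q (subst (0ℚ <_) (sym (diff-sq-up p))
                                       (pos+pos>0 p>0 (ℚP.<-trans p>0 p<p′)))
      sq-shrinks : p′ < 0ℚ → p′ * p′ < p * p
      sq-shrinks p′<0 = 0<q-p⇒p<q (subst (0ℚ <_) (sym (diff-sq-down p))
                                         (pos+pos>0 (p<0⇒0<-p p′<0) (p<0⇒0<-p (ℚP.<-trans p<p′ p′<0))))
      shift : Positive (p ⟨ q ⟩) → Positive (p′ ⟨ q ⟩)
      shift (inj₁ (p>0 , q≥0)) = inj₁ (ℚP.<-trans p>0 p<p′ , q≥0)
      shift (inj₂ (inj₁ (p≥0 , q>0))) = inj₂ (inj₁ (ℚP.<⇒≤ (ℚP.≤-<-trans p≥0 p<p′) , q>0))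
      shift (inj₂ (inj₂ (inj₁ (p>0 , q<0 , lt)))) =
        inj₂ (inj₂ (inj₁ (ℚP.<-trans p>0 p<p′ , q<0 , ℚP.<-trans lt (sq-grows p>0))))
      shift (inj₂ (inj₂ (inj₂ (p<0 , q>0 , lt)))) with ℚP.<-cmp p′ 0ℚ
      ... | tri< p′<0 _ _ = inj₂ (inj₂ (inj₂ (p′<0 , q>0 , ℚP.<-trans (sq-shrinks p′<0) lt)))
      ... | tri≈ _ p′≡0 _ = inj₂ (inj₁ (ℚP.≤-reflexive (sym p′≡0) , q>0))
      ... | tri> _ _ p′>0 = inj₂ (inj₁ (ℚP.<⇒≤ p′>0 , q>0))

  -- w² = (p² + q²D) + 2pq√D, and (p² + q²D)² − (2pq)²D = N(w)² > 0
  Positive-square : ∀ w → ¬ N w ≡ 0ℚ → Positive (w ⊗ w)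
  Positive-square (p ⟨ q ⟩) Nw≢0 = Positive-fromNorm (p * p + q * q * Dℚ) (p * q + q * p) re>0
      (0<q-p⇒p<q (subst (0ℚ <_) (sym (norm-of-square p q Dℚ)) (square>0 Nw≢0)))
    where
      norm-of-square : ∀ p q g → (p * p + q * q * g) * (p * p + q * q * g) - (p * q + q * p) * (p * q + q * p) * g
                                 ≡ (p * p + q * - q * g) * (p * p + q * - q * g)
      norm-of-square = RS.solve-∀ ℚ-ring
      gap₁ : ∀ p q g → (p * p + q * q * g) - (p * p + q * - q * g) ≡ q * q * g + q * q * g
      gap₁ = RS.solve-∀ ℚ-ring
      gap₂ : ∀ p q g → (p * p + q * q * g) - (- (p * p + q * - q * g)) ≡ p * p + p * p
      gap₂ = RS.solve-∀ ℚ-ring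
      n = p * p + q * - q * Dℚ
      q²D≥0 : 0ℚ ≤ q * q * Dℚ
      q²D≥0 = nonNeg*nonNeg≥0 (square≥0 q) 0≤Dℚ
      n≤re : n ≤ p * p + q * q * Dℚ
      n≤re = 0≤q-p⇒p≤q (subst (0ℚ ≤_) (sym (gap₁ p q Dℚ)) (ℚP.+-mono-≤ q²D≥0 q²D≥0))
      -n≤re : - n ≤ p * p + q * q * Dℚ
      -n≤re = 0≤q-p⇒p≤q (subst (0ℚ ≤_) (sym (gap₂ p q Dℚ)) (ℚP.+-mono-≤ (square≥0 p) (square≥0 p)))
      re>0 : 0ℚ < p * p + q * q * Dℚ
      re>0 with ℚP.<-cmp n 0ℚ
      ... | tri< n<0 _ _ = ℚP.<-≤-trans (p<0⇒0<-p n<0) -n≤re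
      ... | tri≈ _ n≡0 _ = ⊥-elim (Nw≢0 n≡0)
      ... | tri> _ _ n>0 = ℚP.<-≤-trans n>0 n≤re

  ⊖≡0K⇒≡ : ∀ x y → x ⊖ y ≡ 0K → x ≡ y
  ⊖≡0K⇒≡ x y x-y≡0 = begin
    x             ≡⟨ solve 2 (λ x y → x := (x :- y) :+ y) refl x y ⟩
    (x ⊖ y) ⊕ y   ≡⟨ cong (_⊕ y) x-y≡0 ⟩
    0K ⊕ y        ≡⟨ ⊕-identityˡ y ⟩
    y             ∎
    where open ≡-Reasoning

  NonNegK : K → Set
  NonNegK x = x ≡ 0K ⊎ Positive x

  ≤K⇒NonNegK : ∀ {x y} → x ≤K y → NonNegK (y ⊖ x)
  ≤K⇒NonNegK {x} (inj₁ refl) = inj₁ (⊕-inverseʳ x)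
  ≤K⇒NonNegK (inj₂ pos) = inj₂ pos

  NonNegK⇒≤K : ∀ {x y} → NonNegK (y ⊖ x) → x ≤K y
  NonNegK⇒≤K {x} {y} (inj₁ y-x≡0) = inj₁ (sym (⊖≡0K⇒≡ y x y-x≡0))
  NonNegK⇒≤K (inj₂ pos) = inj₂ pos

  NonNegK-scale : ∀ r x → 0ℚ ≤ r → NonNegK x → NonNegK (fromℚ r ⊗ x)
  NonNegK-scale r x r≥0 x≥0 with ℚP.<-cmp 0ℚ r | x≥0
  ... | tri< r>0 _ _ | inj₁ refl = inj₁ (solve 1 (λ r → r :* con (+ 0) := con (+ 0)) refl (fromℚ r))
  ... | tri< r>0 _ _ | inj₂ pos = inj₂ (Positive-scale r x r>0 pos)
  ... | tri≈ _ refl _ | _ = inj₁ (solve 1 (λ x → con (+ 0) :* x := con (+ 0)) refl x)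
  ... | tri> _ _ r<0 | _ = ⊥-elim (<⇒≱ r<0 r≥0)

  NonNegK-scale⇒0≤ : ∀ r x → Positive x → NonNegK (fromℚ r ⊗ x) → 0ℚ ≤ r
  NonNegK-scale⇒0≤ r x x>0 rx≥0 with ℚP.<-cmp r 0ℚ
  ... | tri< r<0 _ _ = ⊥-elim (contradiction rx≥0)
    where
      -r·x>0 : Positive (fromℚ (- r) ⊗ x)
      -r·x>0 = Positive-scale (- r) x (p<0⇒0<-p r<0) x>0
      -r·x≡⊝[r·x] : fromℚ (- r) ⊗ x ≡ ⊝ (fromℚ r ⊗ x)
      -r·x≡⊝[r·x] = solve 2 (λ a p → (:- a) :* p := :- (a :* p)) refl (fromℚ r) x
      contradiction : ¬ NonNegK (fromℚ r ⊗ x)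
      contradiction (inj₁ rx≡0) = ¬Positive-0K (subst Positive (trans -r·x≡⊝[r·x] (cong ⊝_ rx≡0)) -r·x>0)
      contradiction (inj₂ rx>0) = Positive⇒¬Positive-⊝ _ rx>0 (subst Positive -r·x≡⊝[r·x] -r·x>0)
  ... | tri≈ _ r≡0 _ = ℚP.≤-reflexive (sym r≡0)
  ... | tri> _ _ r>0 = ℚP.<⇒≤ r>0

  conj-⊗ : ∀ x y → conj (x ⊗ y) ≡ conj x ⊗ conj y
  conj-⊗ (a ⟨ b ⟩) (c ⟨ d ⟩) = cong₂ _⟨_⟩ (re-part a b c d Dℚ) (im-part a b c d)
    where re-part : ∀ a b c d g → a * c + b * d * g ≡ a * c + - b * - d * g
          re-part = RS.solve-∀ ℚ-ring
          im-part : ∀ a b c d → - (a * d + b * c) ≡ a * - d + - b * c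
          im-part = RS.solve-∀ ℚ-ring

  conj-⊕ : ∀ x y → conj (x ⊕ y) ≡ conj x ⊕ conj y
  conj-⊕ (a ⟨ b ⟩) (c ⟨ d ⟩) = cong ((a + c) ⟨_⟩) (ℚP.neg-distrib-+ b d)

  conj-conj : ∀ x → conj (conj x) ≡ x
  conj-conj (a ⟨ b ⟩) = cong (a ⟨_⟩) (neg-involutive b)

  ⊕-conj≡Tr : ∀ x → x ⊕ conj x ≡ fromℚ (Tr x)
  ⊕-conj≡Tr (a ⟨ b ⟩) = cong ((a + a) ⟨_⟩) (ℚP.+-inverseʳ b)

  ⊗-conj≡N : ∀ x → x ⊗ conj x ≡ fromℚ (N x)
  ⊗-conj≡N (a ⟨ b ⟩) = cong ((a * a + b * - b * Dℚ) ⟨_⟩) (im-part a b)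
    where im-part : ∀ a b → a * - b + b * a ≡ 0ℚ
          im-part = RS.solve-∀ ℚ-ring

  fromℚ-injective : ∀ {p q} → fromℚ p ≡ fromℚ q → p ≡ q
  fromℚ-injective = cong re

  emb-oneOK : emb oneOK ≡ 1K
  emb-oneOK = solve 1 (λ w → con (+ 1) :+ con (+ 0) :* w := con (+ 1)) refl ω

  N-1K : N 1K ≡ 1ℚ
  N-1K = unit Dℚ
    where unit : ∀ g → 1ℚ * 1ℚ + 0ℚ * - 0ℚ * g ≡ 1ℚ
          unit = RS.solve-∀ ℚ-ring

  normSq·α²-1K : ∀ s → normSq·α² s 1K ≡ s ⊕ 1K
  normSq·α²-1K = solve 1 (λ s → s :* con (+ 1) :* con (+ 1) :+ con (+ 1) :* con (+ 1) := s :+ con (+ 1)) refl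

  N⁺ : K → ℚ
  N⁺ y = N y + 1ℚ

  -- (s y + ȳ)(y + ȳ) = (s y² + ȳ²) + (s + 1) y ȳ, and s y² + ȳ² = s + 1 when the norms agree;
  -- so cos θ = N⁺ y / Tr y.
  inner·Tr≡normSq·N⁺ : ∀ s y → normSq·α² s 1K ≡ normSq·α² s y →
                       inner·α² s 1K y ⊗ fromℚ (Tr y) ≡ normSq·α² s 1K ⊗ fromℚ (N⁺ y)
  inner·Tr≡normSq·N⁺ s y equal-norms = begin
      inner·α² s 1K y ⊗ fromℚ (Tr y)
        ≡⟨ cong (inner·α² s 1K y ⊗_) (sym (⊕-conj≡Tr y)) ⟩
      (s ⊗ 1K ⊗ y ⊕ 1K ⊗ ȳ) ⊗ (y ⊕ ȳ)
        ≡⟨ solve 3 (λ s y ȳ → (s :* con (+ 1) :* y :+ con (+ 1) :* ȳ) :* (y :+ ȳ)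
                   := (s :* con (+ 1) :* con (+ 1) :+ con (+ 1) :* con (+ 1)) :* (y :* ȳ :+ con (+ 1))
                      :+ ((s :* y :* y :+ ȳ :* ȳ) :- (s :* con (+ 1) :* con (+ 1) :+ con (+ 1) :* con (+ 1))))
                refl s y ȳ ⟩
      P ⊗ (y ⊗ ȳ ⊕ 1K) ⊕ (normSq·α² s y ⊖ P)
        ≡⟨ cong (λ z → P ⊗ (y ⊗ ȳ ⊕ 1K) ⊕ (z ⊖ P)) (sym equal-norms) ⟩
      P ⊗ (y ⊗ ȳ ⊕ 1K) ⊕ (P ⊖ P)
        ≡⟨ cong (P ⊗ (y ⊗ ȳ ⊕ 1K) ⊕_) (⊕-inverseʳ P) ⟩
      P ⊗ (y ⊗ ȳ ⊕ 1K) ⊕ 0K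
        ≡⟨ ⊕-identityʳ _ ⟩
      P ⊗ (y ⊗ ȳ ⊕ 1K)
        ≡⟨ cong (λ z → P ⊗ (z ⊕ 1K)) (⊗-conj≡N y) ⟩
      P ⊗ fromℚ (N y + 1ℚ) ∎
    where
      open ≡-Reasoning
      ȳ = conj y
      P = normSq·α² s 1K

  [1-ȳ²][1-y²]≡N⁺²-Tr² : ∀ y → (1K ⊖ conj y ⊗ conj y) ⊗ (1K ⊖ y ⊗ y) ≡ fromℚ (N⁺ y * N⁺ y - Tr y * Tr y)
  [1-ȳ²][1-y²]≡N⁺²-Tr² y = begin
      (1K ⊖ ȳ ⊗ ȳ) ⊗ (1K ⊖ y ⊗ y)
        ≡⟨ solve 2 (λ y ȳ → (con (+ 1) :- ȳ :* ȳ) :* (con (+ 1) :- y :* y)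
             := con (+ 1) :- (y :+ ȳ) :* (y :+ ȳ) :+ con (+ 2) :* (y :* ȳ) :+ (y :* ȳ) :* (y :* ȳ)) refl y ȳ ⟩
      1K ⊖ (y ⊕ ȳ) ⊗ (y ⊕ ȳ) ⊕ κ (+ 2) ⊗ (y ⊗ ȳ) ⊕ (y ⊗ ȳ) ⊗ (y ⊗ ȳ)
        ≡⟨ cong₂ (λ u v → 1K ⊖ u ⊗ u ⊕ κ (+ 2) ⊗ v ⊕ v ⊗ v) (⊕-conj≡Tr y) (⊗-conj≡N y) ⟩
      1K ⊖ fromℚ t ⊗ fromℚ t ⊕ κ (+ 2) ⊗ fromℚ n ⊕ fromℚ n ⊗ fromℚ n
        ≡⟨ cong₂ (λ u v → 1K ⊖ u ⊕ v ⊕ fromℚ n ⊗ fromℚ n) (fromℚ-⊗ t t) (fromℚ-⊗ (ι (+ 2)) n) ⟩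
      1K ⊖ fromℚ (t * t) ⊕ fromℚ (ι (+ 2) * n) ⊕ fromℚ n ⊗ fromℚ n
        ≡⟨ cong (λ u → 1K ⊖ fromℚ (t * t) ⊕ fromℚ (ι (+ 2) * n) ⊕ u) (fromℚ-⊗ n n) ⟩
      fromℚ (1ℚ - t * t + ι (+ 2) * n + n * n)
        ≡⟨ cong fromℚ (expand t n) ⟩
      fromℚ ((n + 1ℚ) * (n + 1ℚ) - t * t) ∎
    where
      open ≡-Reasoning
      ȳ = conj y
      t = Tr y
      n = N y
      expand : ∀ t n → 1ℚ - t * t + ι (+ 2) * n + n * n ≡ (n + 1ℚ) * (n + 1ℚ) - t * t
      expand = RS.solve-∀ ℚ-ring

  -- I·t = P·q turns 4at(½P ∓ I) into a(2t ∓ 4q)P; here ½ + ½ computes to 1.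
  eliminate-inner⁻ : ∀ a t q P I → I ⊗ t ≡ P ⊗ q →
                     κ (+ 4) ⊗ (a ⊗ t) ⊗ (fromℚ ½ ⊗ P ⊖ I) ≡ a ⊗ (κ (+ 2) ⊗ t ⊖ κ (+ 4) ⊗ q) ⊗ P
  eliminate-inner⁻ a t q P I I·t≡P·q = begin
      κ (+ 4) ⊗ (a ⊗ t) ⊗ (H ⊗ P ⊖ I)
        ≡⟨ solve 5 (λ a t h p i → con (+ 4) :* (a :* t) :* (h :* p :- i)
                := con (+ 2) :* (a :* t) :* p :* (h :+ h) :- con (+ 4) :* a :* (i :* t)) refl a t H P I ⟩
      κ (+ 2) ⊗ (a ⊗ t) ⊗ P ⊗ 1K ⊖ κ (+ 4) ⊗ a ⊗ (I ⊗ t)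
        ≡⟨ cong (λ z → κ (+ 2) ⊗ (a ⊗ t) ⊗ P ⊗ 1K ⊖ κ (+ 4) ⊗ a ⊗ z) I·t≡P·q ⟩
      κ (+ 2) ⊗ (a ⊗ t) ⊗ P ⊗ 1K ⊖ κ (+ 4) ⊗ a ⊗ (P ⊗ q)
        ≡⟨ solve 4 (λ a t p q → con (+ 2) :* (a :* t) :* p :* con (+ 1) :- con (+ 4) :* a :* (p :* q)
                := a :* (con (+ 2) :* t :- con (+ 4) :* q) :* p) refl a t P q ⟩
      a ⊗ (κ (+ 2) ⊗ t ⊖ κ (+ 4) ⊗ q) ⊗ P ∎
    where
      open ≡-Reasoning
      H = fromℚ ½

  eliminate-inner⁺ : ∀ a t q P I → I ⊗ t ≡ P ⊗ q →
                     κ (+ 4) ⊗ (a ⊗ t) ⊗ (I ⊖ ⊝ (fromℚ ½ ⊗ P)) ≡ a ⊗ (κ (+ 2) ⊗ t ⊕ κ (+ 4) ⊗ q) ⊗ P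
  eliminate-inner⁺ a t q P I I·t≡P·q = begin
      κ (+ 4) ⊗ (a ⊗ t) ⊗ (I ⊖ ⊝ (H ⊗ P))
        ≡⟨ solve 5 (λ a t h p i → con (+ 4) :* (a :* t) :* (i :- (:- (h :* p)))
                := con (+ 2) :* (a :* t) :* p :* (h :+ h) :+ con (+ 4) :* a :* (i :* t)) refl a t H P I ⟩
      κ (+ 2) ⊗ (a ⊗ t) ⊗ P ⊗ 1K ⊕ κ (+ 4) ⊗ a ⊗ (I ⊗ t)
        ≡⟨ cong (λ z → κ (+ 2) ⊗ (a ⊗ t) ⊗ P ⊗ 1K ⊕ κ (+ 4) ⊗ a ⊗ z) I·t≡P·q ⟩
      κ (+ 2) ⊗ (a ⊗ t) ⊗ P ⊗ 1K ⊕ κ (+ 4) ⊗ a ⊗ (P ⊗ q)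
        ≡⟨ solve 4 (λ a t p q → con (+ 2) :* (a :* t) :* p :* con (+ 1) :+ con (+ 4) :* a :* (p :* q)
                := a :* (con (+ 2) :* t :+ con (+ 4) :* q) :* p) refl a t P q ⟩
      a ⊗ (κ (+ 2) ⊗ t ⊕ κ (+ 4) ⊗ q) ⊗ P ∎
    where
      open ≡-Reasoning
      H = fromℚ ½

  -- s = c (1 − ȳ²)² solves s + 1 = s y² + ȳ², i.e. s (1 − y²) = −(1 − ȳ²), once c N(1 − ȳ²) = −1.
  balancing-norms : ∀ y c → c * (N⁺ y * N⁺ y - Tr y * Tr y) ≡ - 1ℚ →
                    let w = 1K ⊖ conj y ⊗ conj y ; s = fromℚ c ⊗ (w ⊗ w) in
                    normSq·α² s 1K ≡ normSq·α² s y
  balancing-norms y c cN≡-1 = ⊖≡0K⇒≡ _ _ (begin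
      normSq·α² s 1K ⊖ normSq·α² s y
        ≡⟨ solve 3 (λ C y ȳ → (C :* ((con (+ 1) :- ȳ :* ȳ) :* (con (+ 1) :- ȳ :* ȳ))) :* con (+ 1) :* con (+ 1)
                              :+ con (+ 1) :* con (+ 1)
                              :- ((C :* ((con (+ 1) :- ȳ :* ȳ) :* (con (+ 1) :- ȳ :* ȳ))) :* y :* y :+ ȳ :* ȳ)
               := (con (+ 1) :- ȳ :* ȳ) :* (C :* ((con (+ 1) :- ȳ :* ȳ) :* (con (+ 1) :- y :* y)) :+ con (+ 1)))
             refl (fromℚ c) y (conj y) ⟩
      w ⊗ (fromℚ c ⊗ (w ⊗ (1K ⊖ y ⊗ y)) ⊕ 1K)
        ≡⟨ cong (λ z → w ⊗ (fromℚ c ⊗ z ⊕ 1K)) ([1-ȳ²][1-y²]≡N⁺²-Tr² y) ⟩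
      w ⊗ (fromℚ c ⊗ fromℚ (N⁺ y * N⁺ y - Tr y * Tr y) ⊕ 1K)
        ≡⟨ cong (λ z → w ⊗ (z ⊕ 1K)) (trans (fromℚ-⊗ c _) (cong fromℚ cN≡-1)) ⟩
      w ⊗ (fromℚ (- 1ℚ) ⊕ 1K)
        ≡⟨ solve 1 (λ w → w :* con (+ 0) := con (+ 0)) refl w ⟩
      0K ∎)
    where
      open ≡-Reasoning
      w = 1K ⊖ conj y ⊗ conj y
      s = fromℚ c ⊗ (w ⊗ w)

  -- With v = 1/(−Tr y), the cosine law gives I = P·(−N⁺ y · v), so ½P ∓ I are non-negative
  -- multiples of P when 2 |N⁺ y| ≤ −Tr y.
  small-cosine⇒AbsLe : ∀ s y → Positive s → normSq·α² s 1K ≡ normSq·α² s y → Tr y < 0ℚ →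
                       0ℚ ≤ N⁺ y + N⁺ y - Tr y → 0ℚ ≤ - Tr y - (N⁺ y + N⁺ y) →
                       AbsLe (inner·α² s 1K y) (fromℚ ½ ⊗ normSq·α² s 1K)
  small-cosine⇒AbsLe s y s>0 equal-norms t<0 lower upper = lo , hi
    where
      t = Tr y
      Q = N⁺ y
      P = normSq·α² s 1K
      I = inner·α² s 1K y
      H = fromℚ ½
      P>0 : Positive P
      P>0 = subst Positive (sym (normSq·α²-1K s)) (Positive-⊕1K s s>0)
      inverse = reciprocal (- t) (p<0⇒0<-p t<0)
      v = proj₁ inverse
      v>0 = proj₁ (proj₂ inverse)
      v·-t≡1 = proj₂ (proj₂ inverse)
      t·-v≡1 : t * - v ≡ 1ℚ
      t·-v≡1 = trans (swap t v) v·-t≡1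
        where swap : ∀ t v → t * - v ≡ v * - t
              swap = RS.solve-∀ ℚ-ring
      I≡P·cos : I ≡ P ⊗ fromℚ (Q * - v)
      I≡P·cos = begin
          I                             ≡⟨ sym (⊗-identityʳ I) ⟩
          I ⊗ fromℚ 1ℚ                  ≡⟨ cong (λ z → I ⊗ fromℚ z) (sym t·-v≡1) ⟩
          I ⊗ fromℚ (t * - v)           ≡⟨ cong (I ⊗_) (sym (fromℚ-⊗ t (- v))) ⟩
          I ⊗ (fromℚ t ⊗ fromℚ (- v))   ≡⟨ sym (⊗-assoc I _ _) ⟩
          I ⊗ fromℚ t ⊗ fromℚ (- v)     ≡⟨ cong (_⊗ fromℚ (- v)) (inner·Tr≡normSq·N⁺ s y equal-norms) ⟩
          P ⊗ fromℚ Q ⊗ fromℚ (- v)     ≡⟨ ⊗-assoc P _ _ ⟩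
          P ⊗ (fromℚ Q ⊗ fromℚ (- v))   ≡⟨ cong (P ⊗_) (fromℚ-⊗ Q (- v)) ⟩
          P ⊗ fromℚ (Q * - v)           ∎
        where open ≡-Reasoning
      split : ∀ {ρ a} → ρ ≡ ½ * (1ℚ - v * - t) + v * (a * ½) → 0ℚ ≤ a → 0ℚ ≤ ρ
      split {ρ} {a} ρ≡ a≥0 = subst (0ℚ ≤_) (sym (trans ρ≡ (trans (cong (λ z → ½ * (1ℚ - z) + v * (a * ½)) v·-t≡1)
                                                               (drop (v * (a * ½))))))
                                   (nonNeg*nonNeg≥0 (ℚP.<⇒≤ v>0) (nonNeg*nonNeg≥0 a≥0 (ℚP.<⇒≤ (ℚP.positive⁻¹ ½))))
        where drop : ∀ a → ½ * (1ℚ - 1ℚ) + a ≡ a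
              drop = RS.solve-∀ ℚ-ring
      ρ₁-form : ∀ Q v t → ½ - Q * - v ≡ ½ * (1ℚ - v * - t) + v * ((Q + Q - t) * ½)
      ρ₁-form = RS.solve-∀ ℚ-ring
      ρ₂-form : ∀ Q v t → Q * - v + ½ ≡ ½ * (1ℚ - v * - t) + v * ((- t - (Q + Q)) * ½)
      ρ₂-form = RS.solve-∀ ℚ-ring
      hi : I ≤K H ⊗ P
      hi = NonNegK⇒≤K (subst NonNegK ρ₁P≡ (NonNegK-scale _ P (split (ρ₁-form Q v t) lower) (inj₂ P>0)))
        where ρ₁P≡ : fromℚ (½ - Q * - v) ⊗ P ≡ H ⊗ P ⊖ I
              ρ₁P≡ = sym (trans (cong (H ⊗ P ⊖_) I≡P·cos)
                       (solve 3 (λ h p g → h :* p :- p :* g := (h :- g) :* p) refl H P (fromℚ (Q * - v))))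
      lo : ⊝ (H ⊗ P) ≤K I
      lo = NonNegK⇒≤K (subst NonNegK ρ₂P≡ (NonNegK-scale _ P (split (ρ₂-form Q v t) upper) (inj₂ P>0)))
        where ρ₂P≡ : fromℚ (Q * - v + ½) ⊗ P ≡ I ⊖ ⊝ (H ⊗ P)
              ρ₂P≡ = sym (trans (cong (_⊖ ⊝ (H ⊗ P)) I≡P·cos)
                       (solve 3 (λ h p g → p :* g :- (:- (h :* p)) := (g :+ h) :* p) refl H P (fromℚ (Q * - v))))

  small-cosine⇒minimal : ∀ y → Tr y < 0ℚ → 0ℚ ≤ N⁺ y + N⁺ y - Tr y → 0ℚ ≤ - Tr y - (N⁺ y + N⁺ y) →
                         Σ K (λ s → MinimalWith s 1K y)
  small-cosine⇒minimal y t<0 lower upper =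
    s , s>0 , equal-norms , small-cosine⇒AbsLe s y s>0 equal-norms t<0 lower upper
    where
      t = Tr y
      Q = N⁺ y
      -- 4 (t² − Q²) = (2Q − t)(−t − 2Q) + 3t²
      d = t * t - Q * Q
      d≡ : ∀ t Q → t * t - Q * Q ≡ ((Q + Q - t) * (- t - (Q + Q)) + (t * t + t * t + t * t)) * (+ 1 / 4)
      d≡ = RS.solve-∀ ℚ-ring
      t²>0 = neg*neg>0 t<0 t<0
      d>0 : 0ℚ < d
      d>0 = subst (0ℚ <_) (sym (d≡ t Q))
              (pos*pos>0 (nonNeg+pos>0 (nonNeg*nonNeg≥0 lower upper) (pos+pos>0 (pos+pos>0 t²>0 t²>0) t²>0))
                         (ℚP.positive⁻¹ (+ 1 / 4)))
      inverse = reciprocal d d>0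
      c = proj₁ inverse
      c>0 = proj₁ (proj₂ inverse)
      c·d≡1 = proj₂ (proj₂ inverse)
      c·N≡-1 : c * (Q * Q - t * t) ≡ - 1ℚ
      c·N≡-1 = trans (flip c (Q * Q) (t * t)) (cong -_ c·d≡1)
        where flip : ∀ c a b → c * (a - b) ≡ - (c * (b - a))
              flip = RS.solve-∀ ℚ-ring
      w = 1K ⊖ conj y ⊗ conj y
      s = fromℚ c ⊗ (w ⊗ w)
      equal-norms = balancing-norms y c c·N≡-1
      conj-w : conj w ≡ 1K ⊖ y ⊗ y
      conj-w = trans (conj-⊕ 1K (⊝ (conj y ⊗ conj y)))
                     (cong (1K ⊖_) (trans (conj-⊗ (conj y) (conj y)) (cong₂ _⊗_ (conj-conj y) (conj-conj y))))
      Nw≡ : N w ≡ Q * Q - t * t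
      Nw≡ = fromℚ-injective (trans (sym (⊗-conj≡N w)) (trans (cong (w ⊗_) conj-w) ([1-ȳ²][1-y²]≡N⁺²-Tr² y)))
      Nw≢0 : ¬ N w ≡ 0ℚ
      Nw≢0 Nw≡0 = ℚP.<-irrefl (sym (trans (negate (t * t) (Q * Q)) (cong -_ (trans (sym Nw≡) Nw≡0)))) d>0
        where negate : ∀ a b → a - b ≡ - (b - a)
              negate = RS.solve-∀ ℚ-ring
      s>0 = Positive-scale c (w ⊗ w) c>0 (Positive-square w Nw≢0)

  record OmegaData : Set where
    field
      τ : ℤ
      ω+ω̄≡τ : ω ⊕ conj ω ≡ κ τ
      τ²-4ωω̄≡Δ : κ τ ⊗ κ τ ⊖ κ (+ 4) ⊗ (ω ⊗ conj ω) ≡ κ Δ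
      5≤Δ : + 5 ℤ.≤ Δ

  ω-1mod4 : D≡1mod4? ≡ true → ω ≡ ½ ⟨ ½ ⟩
  ω-1mod4 = cong (λ b → if b then ½ ⟨ ½ ⟩ else 0ℚ ⟨ 1ℚ ⟩)

  Δ-1mod4 : D≡1mod4? ≡ true → Δ ≡ + D
  Δ-1mod4 = cong (λ b → if b then + D else + (4 ℕ.* D))

  ω-2,3mod4 : D≡1mod4? ≡ false → ω ≡ 0ℚ ⟨ 1ℚ ⟩
  ω-2,3mod4 = cong (λ b → if b then ½ ⟨ ½ ⟩ else 0ℚ ⟨ 1ℚ ⟩)

  Δ-2,3mod4 : D≡1mod4? ≡ false → Δ ≡ + (4 ℕ.* D)
  Δ-2,3mod4 = cong (λ b → if b then + D else + (4 ℕ.* D))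

  omegaData-1mod4 : D≡1mod4? ≡ true → 5 ℕ.≤ D → OmegaData
  omegaData-1mod4 eq 5≤D = record
    { τ = + 1
    ; ω+ω̄≡τ = subst (λ w → w ⊕ conj w ≡ κ (+ 1)) (sym ω≡) refl
    ; τ²-4ωω̄≡Δ = subst₂ (λ w d → κ (+ 1) ⊗ κ (+ 1) ⊖ κ (+ 4) ⊗ (w ⊗ conj w) ≡ κ d) (sym ω≡) (sym Δ≡)
                   (cong₂ _⟨_⟩ (re-part Dℚ) (im-part Dℚ))
    ; 5≤Δ = subst (+ 5 ℤ.≤_) (sym Δ≡) (ℤ.+≤+ 5≤D) }
    where
      ω≡ = ω-1mod4 eq
      Δ≡ = Δ-1mod4 eq
      re-part : ∀ g → (1ℚ * 1ℚ + 0ℚ * 0ℚ * g) + - (ι (+ 4) * (½ * ½ + ½ * (- ½) * g) + 0ℚ * (½ * (- ½) + ½ * ½) * g) ≡ g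
      re-part = RS.solve-∀ ℚ-ring
      im-part : ∀ g → (1ℚ * 0ℚ + 0ℚ * 1ℚ) + - (ι (+ 4) * (½ * (- ½) + ½ * ½) + 0ℚ * (½ * ½ + ½ * (- ½) * g)) ≡ 0ℚ
      im-part = RS.solve-∀ ℚ-ring

  omegaData-2,3mod4 : D≡1mod4? ≡ false → 2 ℕ.≤ D → OmegaData
  omegaData-2,3mod4 eq 2≤D = record
    { τ = + 0
    ; ω+ω̄≡τ = subst (λ w → w ⊕ conj w ≡ κ (+ 0)) (sym ω≡) refl
    ; τ²-4ωω̄≡Δ = subst₂ (λ w d → κ (+ 0) ⊗ κ (+ 0) ⊖ κ (+ 4) ⊗ (w ⊗ conj w) ≡ κ d) (sym ω≡) (sym Δ≡)
                   (cong₂ _⟨_⟩ (trans (re-part Dℚ) (sym ι[4D])) (im-part Dℚ))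
    ; 5≤Δ = subst (+ 5 ℤ.≤_) (sym Δ≡) (ℤ.+≤+ (ℕP.≤-trans (ℕ.s≤s (ℕ.s≤s (ℕ.s≤s (ℕ.s≤s (ℕ.s≤s ℕ.z≤n)))))
                                                       (ℕP.*-monoʳ-≤ 4 2≤D))) }
    where
      ω≡ = ω-2,3mod4 eq
      Δ≡ = Δ-2,3mod4 eq
      ι[4D] : ι (+ (4 ℕ.* D)) ≡ ι (+ 4) * Dℚ
      ι[4D] = trans (cong ι (ℤP.pos-* 4 D)) (ι-* (+ 4) (+ D))
      re-part : ∀ g → (0ℚ * 0ℚ + 0ℚ * 0ℚ * g) + - (ι (+ 4) * (0ℚ * 0ℚ + 1ℚ * (- 1ℚ) * g) + 0ℚ * (0ℚ * (- 1ℚ) + 1ℚ * 0ℚ) * g) ≡ ι (+ 4) * g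
      re-part = RS.solve-∀ ℚ-ring
      im-part : ∀ g → (0ℚ * 0ℚ + 0ℚ * 0ℚ) + - (ι (+ 4) * (0ℚ * (- 1ℚ) + 1ℚ * 0ℚ) + 0ℚ * (0ℚ * 0ℚ + 1ℚ * (- 1ℚ) * g)) ≡ 0ℚ
      im-part = RS.solve-∀ ℚ-ring

  omegaData : 1 ℕ.< D → OmegaData
  omegaData 1<D with D≡1mod4? in eq
  ... | true = omegaData-1mod4 eq (1<D⇒1[mod4]⇒5≤D D 1<D eq)
  ... | false = omegaData-2,3mod4 eq 1<D

  module WithOmega (od : OmegaData) where
    open OmegaData od

    Trℤ : ℤ → ℤ → ℤ
    Trℤ m n = + 2 ℤ.* m ℤ.+ n ℤ.* τ

    -- 4 · N⁺ (m ± ω)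
    Xℤ : ℤ → ℤ → ℤ
    Xℤ m n = Trℤ m n ℤ.* Trℤ m n ℤ.- Δ ℤ.+ + 4

    Mℤ : ℤ
    Mℤ = Δ ℤ.- + 3

    conj-emb : ∀ m n → conj (emb (m , n)) ≡ κ m ⊕ κ n ⊗ conj ω
    conj-emb m n = trans (conj-⊕ (κ m) (κ n ⊗ ω)) (cong (κ m ⊕_) (conj-⊗ (κ n) ω))

    private
      κTr : ∀ m n → κ (Trℤ m n) ≡ κ (+ 2) ⊗ κ m ⊕ κ n ⊗ κ τ
      κTr m n = trans (κ-+ (+ 2 ℤ.* m) (n ℤ.* τ)) (cong₂ _⊕_ (κ-* (+ 2) m) (κ-* n τ))

    Tr-emb : ∀ m n → Tr (emb (m , n)) ≡ ι (Trℤ m n)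
    Tr-emb m n = fromℚ-injective (begin
        fromℚ (Tr (emb (m , n)))
          ≡⟨ sym (⊕-conj≡Tr (emb (m , n))) ⟩
        emb (m , n) ⊕ conj (emb (m , n))
          ≡⟨ cong (emb (m , n) ⊕_) (conj-emb m n) ⟩
        (κ m ⊕ κ n ⊗ ω) ⊕ (κ m ⊕ κ n ⊗ conj ω)
          ≡⟨ solve 4 (λ a c w w̄ → (a :+ c :* w) :+ (a :+ c :* w̄) := con (+ 2) :* a :+ c :* (w :+ w̄))
                   refl (κ m) (κ n) ω (conj ω) ⟩
        κ (+ 2) ⊗ κ m ⊕ κ n ⊗ (ω ⊕ conj ω)
          ≡⟨ cong (λ z → κ (+ 2) ⊗ κ m ⊕ κ n ⊗ z) ω+ω̄≡τ ⟩
        κ (+ 2) ⊗ κ m ⊕ κ n ⊗ κ τ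
          ≡⟨ sym (κTr m n) ⟩
        κ (Trℤ m n) ∎)
      where open ≡-Reasoning

    4N-emb : ∀ m n → n ℤ.* n ≡ + 1 → ι (+ 4) * N (emb (m , n)) ≡ ι (Trℤ m n ℤ.* Trℤ m n ℤ.- Δ)
    4N-emb m n n²≡1 = fromℚ-injective (begin
        fromℚ (ι (+ 4) * N y)
          ≡⟨ sym (fromℚ-⊗ (ι (+ 4)) (N y)) ⟩
        κ (+ 4) ⊗ fromℚ (N y)
          ≡⟨ cong (κ (+ 4) ⊗_) (sym (⊗-conj≡N y)) ⟩
        κ (+ 4) ⊗ (y ⊗ conj y)
          ≡⟨ cong (λ z → κ (+ 4) ⊗ (y ⊗ z)) (conj-emb m n) ⟩
        κ (+ 4) ⊗ ((κ m ⊕ κ n ⊗ ω) ⊗ (κ m ⊕ κ n ⊗ conj ω))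
          ≡⟨ solve 4 (λ a c w w̄ → con (+ 4) :* ((a :+ c :* w) :* (a :+ c :* w̄))
                 := (con (+ 2) :* a :+ c :* (w :+ w̄)) :* (con (+ 2) :* a :+ c :* (w :+ w̄))
                    :- (c :* c) :* ((w :+ w̄) :* (w :+ w̄) :- con (+ 4) :* (w :* w̄)))
               refl (κ m) (κ n) ω (conj ω) ⟩
        tr ω̃ ⊗ tr ω̃ ⊖ (κ n ⊗ κ n) ⊗ (ω̃ ⊗ ω̃ ⊖ κ (+ 4) ⊗ (ω ⊗ conj ω))
          ≡⟨ cong (λ z → tr z ⊗ tr z ⊖ (κ n ⊗ κ n) ⊗ (z ⊗ z ⊖ κ (+ 4) ⊗ (ω ⊗ conj ω))) ω+ω̄≡τ ⟩
        tr (κ τ) ⊗ tr (κ τ) ⊖ (κ n ⊗ κ n) ⊗ (κ τ ⊗ κ τ ⊖ κ (+ 4) ⊗ (ω ⊗ conj ω))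
          ≡⟨ cong₂ (λ u z → tr (κ τ) ⊗ tr (κ τ) ⊖ u ⊗ z) (trans (sym (κ-* n n)) (cong κ n²≡1)) τ²-4ωω̄≡Δ ⟩
        tr (κ τ) ⊗ tr (κ τ) ⊖ 1K ⊗ κ Δ
          ≡⟨ cong₂ (λ u z → u ⊗ u ⊖ z) (sym (κTr m n)) (⊗-identityˡ (κ Δ)) ⟩
        κ (Trℤ m n) ⊗ κ (Trℤ m n) ⊖ κ Δ
          ≡⟨ sym (trans (κ-- (Trℤ m n ℤ.* Trℤ m n) Δ) (cong (_⊖ κ Δ) (κ-* (Trℤ m n) (Trℤ m n)))) ⟩
        κ (Trℤ m n ℤ.* Trℤ m n ℤ.- Δ) ∎)
      where
        open ≡-Reasoning
        y = emb (m , n)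
        ω̃ = ω ⊕ conj ω
        tr : K → K
        tr z = κ (+ 2) ⊗ κ m ⊕ κ n ⊗ z

    4N⁺-emb : ∀ m n → n ℤ.* n ≡ + 1 → ι (+ 4) * N⁺ (emb (m , n)) ≡ ι (Xℤ m n)
    4N⁺-emb m n n²≡1 = begin
        ι (+ 4) * (N (emb (m , n)) + 1ℚ)         ≡⟨ ℚP.*-distribˡ-+ (ι (+ 4)) (N (emb (m , n))) 1ℚ ⟩
        ι (+ 4) * N (emb (m , n)) + ι (+ 4) * 1ℚ  ≡⟨ cong₂ _+_ (4N-emb m n n²≡1) (ℚP.*-identityʳ (ι (+ 4))) ⟩
        ι (Trℤ m n ℤ.* Trℤ m n ℤ.- Δ) + ι (+ 4)   ≡⟨ sym (ι-+ (Trℤ m n ℤ.* Trℤ m n ℤ.- Δ) (+ 4)) ⟩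
        ι (Xℤ m n)                                ∎
      where open ≡-Reasoning

    IsBasis-oneOK⇒unit : ∀ m n → IsBasis oneOK (m , n) → n ≡ + 1 ⊎ n ≡ -[1+ 0 ]
    IsBasis-oneOK⇒unit m n (inj₁ det≡1) = inj₁ (trans (sym (det m n)) det≡1)
      where det : ∀ m n → + 1 ℤ.* n ℤ.- + 0 ℤ.* m ≡ n
            det = ℤ-Solver.solve-∀
    IsBasis-oneOK⇒unit m n (inj₂ det≡-1) = inj₂ (trans (sym (det m n)) det≡-1)
      where det : ∀ m n → + 1 ℤ.* n ℤ.- + 0 ℤ.* m ≡ n
            det = ℤ-Solver.solve-∀

    -- Multiply ½P − I ≥ 0 and I + ½P ≥ 0 by 4σT ≥ 0 and eliminate I; as P > 0, what is left
    -- is the sign of σ(2T ∓ X).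
    minimal⇒bounds : ∀ m n s σ → n ℤ.* n ≡ + 1 → MinimalWith s 1K (emb (m , n)) →
                     + 0 ℤ.≤ σ ℤ.* Trℤ m n →
                     + 0 ℤ.≤ σ ℤ.* (+ 2 ℤ.* Trℤ m n ℤ.- Xℤ m n) × + 0 ℤ.≤ σ ℤ.* (+ 2 ℤ.* Trℤ m n ℤ.+ Xℤ m n)
    minimal⇒bounds m n s σ n²≡1 (s>0 , equal-norms , lo , hi) σT≥0 =
        ι-cancel-≤ {+ 0} (NonNegK-scale⇒0≤ _ P P>0 (subst NonNegK r·[½P-I]≡ (NonNegK-scale r _ r≥0 (≤K⇒NonNegK hi))))
      , ι-cancel-≤ {+ 0} (NonNegK-scale⇒0≤ _ P P>0 (subst NonNegK r·[I+½P]≡ (NonNegK-scale r _ r≥0 (≤K⇒NonNegK lo))))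
      where
        open ≡-Reasoning
        y = emb (m , n)
        T = Trℤ m n
        X = Xℤ m n
        P = normSq·α² s 1K
        I = inner·α² s 1K y
        H = fromℚ ½
        q = fromℚ (N⁺ y)
        I·T≡P·q : I ⊗ κ T ≡ P ⊗ q
        I·T≡P·q = trans (cong (λ z → I ⊗ fromℚ z) (sym (Tr-emb m n))) (inner·Tr≡normSq·N⁺ s y equal-norms)
        P>0 : Positive P
        P>0 = subst Positive (sym (normSq·α²-1K s)) (Positive-⊕1K s s>0)
        r = ι (+ 4 ℤ.* (σ ℤ.* T))
        r≥0 : 0ℚ ≤ r
        r≥0 = ι-mono-≤ (0≤i*j (0≤+ 4) σT≥0)
        r≡ : fromℚ r ≡ κ (+ 4) ⊗ (κ σ ⊗ κ T)
        r≡ = trans (κ-* (+ 4) (σ ℤ.* T)) (cong (κ (+ 4) ⊗_) (κ-* σ T))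
        4q≡X : κ (+ 4) ⊗ q ≡ κ X
        4q≡X = trans (fromℚ-⊗ (ι (+ 4)) (N⁺ y)) (cong fromℚ (4N⁺-emb m n n²≡1))
        σ[2T∓4q]≡ : ∀ (_∓_ : K → K → K) (_∓ℤ_ : ℤ → ℤ → ℤ) → (∀ i j → κ (i ∓ℤ j) ≡ κ i ∓ κ j) →
                    κ σ ⊗ ((κ (+ 2) ⊗ κ T) ∓ (κ (+ 4) ⊗ q)) ≡ κ (σ ℤ.* ((+ 2 ℤ.* T) ∓ℤ X))
        σ[2T∓4q]≡ _∓_ _∓ℤ_ κ-∓ = begin
          κ σ ⊗ ((κ (+ 2) ⊗ κ T) ∓ (κ (+ 4) ⊗ q))  ≡⟨ cong (λ z → κ σ ⊗ ((κ (+ 2) ⊗ κ T) ∓ z)) 4q≡X ⟩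
          κ σ ⊗ ((κ (+ 2) ⊗ κ T) ∓ κ X)            ≡⟨ cong (λ z → κ σ ⊗ (z ∓ κ X)) (sym (κ-* (+ 2) T)) ⟩
          κ σ ⊗ (κ (+ 2 ℤ.* T) ∓ κ X)              ≡⟨ cong (κ σ ⊗_) (sym (κ-∓ (+ 2 ℤ.* T) X)) ⟩
          κ σ ⊗ κ ((+ 2 ℤ.* T) ∓ℤ X)               ≡⟨ sym (κ-* σ ((+ 2 ℤ.* T) ∓ℤ X)) ⟩
          κ (σ ℤ.* ((+ 2 ℤ.* T) ∓ℤ X))             ∎
        r·[½P-I]≡ : fromℚ r ⊗ (H ⊗ P ⊖ I) ≡ fromℚ (ι (σ ℤ.* (+ 2 ℤ.* T ℤ.- X))) ⊗ P
        r·[½P-I]≡ = trans (cong (_⊗ (H ⊗ P ⊖ I)) r≡)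
                      (trans (eliminate-inner⁻ (κ σ) (κ T) q P I I·T≡P·q) (cong (_⊗ P) (σ[2T∓4q]≡ _⊖_ ℤ._-_ κ--)))
        r·[I+½P]≡ : fromℚ r ⊗ (I ⊖ ⊝ (H ⊗ P)) ≡ fromℚ (ι (σ ℤ.* (+ 2 ℤ.* T ℤ.+ X))) ⊗ P
        r·[I+½P]≡ = trans (cong (_⊗ (I ⊖ ⊝ (H ⊗ P))) r≡)
                      (trans (eliminate-inner⁺ (κ σ) (κ T) q P I I·T≡P·q) (cong (_⊗ P) (σ[2T∓4q]≡ _⊕_ ℤ._+_ κ-+)))

    minimal⇒inWindow : ∀ m n s → n ℤ.* n ≡ + 1 → MinimalWith s 1K (emb (m , n)) →
                       (+ 0 ℤ.≤ Trℤ m n → InWindow Mℤ (Trℤ m n))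
                       × (Trℤ m n ℤ.≤ + 0 → InWindow Mℤ (ℤ.- Trℤ m n))
    minimal⇒inWindow m n s n²≡1 minimal = nonneg , nonpos
      where
        T = Trℤ m n
        nonneg : + 0 ℤ.≤ T → InWindow Mℤ T
        nonneg T≥0 = T≥0 , ℤP.0≤i-j⇒j≤i (subst (+ 0 ℤ.≤_) (lower T Δ) (proj₁ bounds))
                         , ℤP.0≤i-j⇒j≤i (subst (+ 0 ℤ.≤_) (upper T Δ) (proj₂ bounds))
          where
            bounds = minimal⇒bounds m n s (+ 1) n²≡1 minimal (subst (+ 0 ℤ.≤_) (sym (ℤP.*-identityˡ T)) T≥0)
            lower : ∀ T d → + 1 ℤ.* (+ 2 ℤ.* T ℤ.- (T ℤ.* T ℤ.- d ℤ.+ + 4)) ≡ (d ℤ.- + 3) ℤ.- (T ℤ.- + 1) ℤ.* (T ℤ.- + 1)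
            lower = ℤ-Solver.solve-∀
            upper : ∀ T d → + 1 ℤ.* (+ 2 ℤ.* T ℤ.+ (T ℤ.* T ℤ.- d ℤ.+ + 4)) ≡ (T ℤ.+ + 1) ℤ.* (T ℤ.+ + 1) ℤ.- (d ℤ.- + 3)
            upper = ℤ-Solver.solve-∀
        nonpos : T ℤ.≤ + 0 → InWindow Mℤ (ℤ.- T)
        nonpos T≤0 = -T≥0 , ℤP.0≤i-j⇒j≤i (subst (+ 0 ℤ.≤_) (lower T Δ) (proj₂ bounds))
                          , ℤP.0≤i-j⇒j≤i (subst (+ 0 ℤ.≤_) (upper T Δ) (proj₁ bounds))
          where
            -T≥0 : + 0 ℤ.≤ ℤ.- T
            -T≥0 = subst (+ 0 ℤ.≤_) (ℤP.+-identityˡ (ℤ.- T)) (ℤP.i≤j⇒0≤j-i T≤0)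
            neg-as-mul : ∀ T → ℤ.- T ≡ -[1+ 0 ] ℤ.* T
            neg-as-mul = ℤ-Solver.solve-∀
            bounds = minimal⇒bounds m n s -[1+ 0 ] n²≡1 minimal (subst (+ 0 ℤ.≤_) (neg-as-mul T) -T≥0)
            lower : ∀ T d → -[1+ 0 ] ℤ.* (+ 2 ℤ.* T ℤ.+ (T ℤ.* T ℤ.- d ℤ.+ + 4))
                            ≡ (d ℤ.- + 3) ℤ.- (ℤ.- T ℤ.- + 1) ℤ.* (ℤ.- T ℤ.- + 1)
            lower = ℤ-Solver.solve-∀
            upper : ∀ T d → -[1+ 0 ] ℤ.* (+ 2 ℤ.* T ℤ.- (T ℤ.* T ℤ.- d ℤ.+ + 4))
                            ≡ (ℤ.- T ℤ.+ + 1) ℤ.* (ℤ.- T ℤ.+ + 1) ℤ.- (d ℤ.- + 3)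
            upper = ℤ-Solver.solve-∀

    u₀ : ℤ → ℤ
    u₀ b = ℤ.- Trℤ b (+ 1)

    -- The r of IsFloorβ is u₀ + 1.
    floor⇒window : ∀ b → IsFloorβ b → SqrtAtMost Mℤ (u₀ b ℤ.+ + 1) × BelowSqrt (u₀ b ℤ.- + 1) Mℤ
    floor⇒window b ((r≥0 , M≤r²) , r-2<√M) =
      (ι-cancel-≤ {+ 0} (subst (0ℚ ≤_) r≡ r≥0) , ι-cancel-≤ (subst (ι Mℤ ≤_) (square (u₀ b ℤ.+ + 1) r≡) M≤r²)) , below r-2<√M
      where
        r = 1ℚ - Tr ω - ι (+ 2 ℤ.* b)
        shift₁ : ∀ b τ → + 1 ℤ.- τ ℤ.- + 2 ℤ.* b ≡ ℤ.- (+ 2 ℤ.* b ℤ.+ + 1 ℤ.* τ) ℤ.+ + 1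
        shift₁ = ℤ-Solver.solve-∀
        shift₂ : ∀ b τ → ℤ.- (+ 2 ℤ.* b ℤ.+ + 1 ℤ.* τ) ℤ.+ + 1 ℤ.- + 2 ≡ ℤ.- (+ 2 ℤ.* b ℤ.+ + 1 ℤ.* τ) ℤ.- + 1
        shift₂ = ℤ-Solver.solve-∀
        Trω≡τ : Tr ω ≡ ι τ
        Trω≡τ = fromℚ-injective (trans (sym (⊕-conj≡Tr ω)) ω+ω̄≡τ)
        r≡ : r ≡ ι (u₀ b ℤ.+ + 1)
        r≡ = trans (cong (λ z → 1ℚ - z - ι (+ 2 ℤ.* b)) Trω≡τ)
               (trans (cong (_- ι (+ 2 ℤ.* b)) (sym (ι-- (+ 1) τ)))
                 (trans (sym (ι-- (+ 1 ℤ.- τ) (+ 2 ℤ.* b))) (cong ι (shift₁ b τ))))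
        r-2≡ : r - ι (+ 2) ≡ ι (u₀ b ℤ.- + 1)
        r-2≡ = trans (cong (_- ι (+ 2)) r≡) (trans (sym (ι-- (u₀ b ℤ.+ + 1) (+ 2))) (cong ι (shift₂ b τ)))
        square : ∀ {p} i → p ≡ ι i → p * p ≡ ι (i ℤ.* i)
        square i p≡ = trans (cong₂ _*_ p≡ p≡) (sym (ι-* i i))
        below : (r - ι (+ 2) < 0ℚ) ⊎ ((r - ι (+ 2)) * (r - ι (+ 2)) < ι Mℤ) → BelowSqrt (u₀ b ℤ.- + 1) Mℤ
        below (inj₁ lt) = inj₁ (ι-cancel-< {_} {+ 0} (subst (_< 0ℚ) r-2≡ lt))
        below (inj₂ lt) = inj₂ (ι-cancel-< (subst (_< ι Mℤ) (square (u₀ b ℤ.- + 1) r-2≡) lt))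

    Φ : ℚ → ℚ
    Φ w = 1ℚ + (w - ι (+ 4)) * (+ 1 / 16) - Δ / 4

    defect : ℤ → ℤ
    defect u = u ℤ.* u ℤ.- Mℤ ℤ.- + 1

    -- With N(1) = 1, F = 1 + N + N² − Δ/4 and 4N + 2 = T² − Δ + 2 = defect T.
    F-emb : ∀ m n → n ℤ.* n ≡ + 1 → F oneOK (m , n) ≡ Φ (ι (defect (Trℤ m n) ℤ.* defect (Trℤ m n)))
    F-emb m n n²≡1 = begin
        F oneOK (m , n)
          ≡⟨ cong (λ nx → nx * nx + nx * ny + ny * ny - Δ / 4) (trans (cong N emb-oneOK) N-1K) ⟩
        1ℚ * 1ℚ + 1ℚ * ny + ny * ny - Δ / 4
          ≡⟨ complete-square ny (Δ / 4) ⟩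
        1ℚ + ((ι (+ 4) * ny + ι (+ 2)) * (ι (+ 4) * ny + ι (+ 2)) - ι (+ 4)) * (+ 1 / 16) - Δ / 4
          ≡⟨ cong (λ z → 1ℚ + (z * z - ι (+ 4)) * (+ 1 / 16) - Δ / 4) 4N+2≡defect ⟩
        1ℚ + (ι (defect T) * ι (defect T) - ι (+ 4)) * (+ 1 / 16) - Δ / 4
          ≡⟨ cong (λ z → 1ℚ + (z - ι (+ 4)) * (+ 1 / 16) - Δ / 4) (sym (ι-* (defect T) (defect T))) ⟩
        Φ (ι (defect T ℤ.* defect T)) ∎
      where
        open ≡-Reasoning
        T = Trℤ m n
        ny = N (emb (m , n))
        complete-square : ∀ x d → 1ℚ * 1ℚ + 1ℚ * x + x * x - d
                                  ≡ 1ℚ + ((ι (+ 4) * x + ι (+ 2)) * (ι (+ 4) * x + ι (+ 2)) - ι (+ 4)) * (+ 1 / 16) - d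
        complete-square = RS.solve-∀ ℚ-ring
        rearrange : ∀ T d → T ℤ.* T ℤ.- d ℤ.+ + 2 ≡ T ℤ.* T ℤ.- (d ℤ.- + 3) ℤ.- + 1
        rearrange = ℤ-Solver.solve-∀
        4N+2≡defect : ι (+ 4) * ny + ι (+ 2) ≡ ι (defect T)
        4N+2≡defect = trans (cong (_+ ι (+ 2)) (4N-emb m n n²≡1))
                        (trans (sym (ι-+ (T ℤ.* T ℤ.- Δ) (+ 2))) (cong ι (rearrange T Δ)))

    private
      neg² : ∀ T → ℤ.- T ℤ.* ℤ.- T ≡ T ℤ.* T
      neg² = ℤ-Solver.solve-∀

    F-window : ∀ b m n j → IsFloorβ b → n ℤ.* n ≡ + 1 → let u = u₀ b ℤ.+ + 2 ℤ.* j in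
               InWindow Mℤ u → u ℤ.* u ≡ Trℤ m n ℤ.* Trℤ m n → F oneOK (m , n) ≡ F oneOK (b , + 1)
    F-window b m n j isFloor n²≡1 u∈W u²≡T² = begin
        F oneOK (m , n)
          ≡⟨ F-emb m n n²≡1 ⟩
        Φ (ι (defect (Trℤ m n) ℤ.* defect (Trℤ m n)))
          ≡⟨ cong (λ z → Φ (ι ((z ℤ.- Mℤ ℤ.- + 1) ℤ.* (z ℤ.- Mℤ ℤ.- + 1)))) (sym u²≡T²) ⟩
        Φ (ι (defect u ℤ.* defect u))
          ≡⟨ cong (λ z → Φ (ι z)) (window-defect² Mℤ (u₀ b) j √M≤u₀+1 u₀-1<√M u∈W) ⟩
        Φ (ι (defect (u₀ b) ℤ.* defect (u₀ b)))
          ≡⟨ cong (λ z → Φ (ι ((z ℤ.- Mℤ ℤ.- + 1) ℤ.* (z ℤ.- Mℤ ℤ.- + 1)))) (neg² (Trℤ b (+ 1))) ⟩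
        Φ (ι (defect (Trℤ b (+ 1)) ℤ.* defect (Trℤ b (+ 1))))
          ≡⟨ sym (F-emb b (+ 1) refl) ⟩
        F oneOK (b , + 1) ∎
      where
        open ≡-Reasoning
        u = u₀ b ℤ.+ + 2 ℤ.* j
        √M≤u₀+1 = proj₁ (floor⇒window b isFloor)
        u₀-1<√M = proj₂ (floor⇒window b isFloor)

    -- |Tr y| ≡ Tr ω ≡ u₀ (mod 2); the offsets j below witness this in each sign case.
    F-unique : ∀ b → IsFloorβ b → ∀ y → Good oneOK y → F oneOK y ≡ F oneOK (b , + 1)
    F-unique b isFloor (m , n) (basis , s , minimal) =
      by-cases (IsBasis-oneOK⇒unit m n basis) (ℤP.≤-total (+ 0) T)
      where
        T = Trℤ m n
        window : n ℤ.* n ≡ + 1 → (+ 0 ℤ.≤ T → InWindow Mℤ T) × (T ℤ.≤ + 0 → InWindow Mℤ (ℤ.- T))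
        window n²≡1 = minimal⇒inWindow m n s n²≡1 (subst (λ z → MinimalWith s z (emb (m , n))) emb-oneOK minimal)
        parity₁ : ∀ m b τ → + 2 ℤ.* m ℤ.+ + 1 ℤ.* τ ≡ ℤ.- (+ 2 ℤ.* b ℤ.+ + 1 ℤ.* τ) ℤ.+ + 2 ℤ.* (m ℤ.+ b ℤ.+ τ)
        parity₁ = ℤ-Solver.solve-∀
        parity₂ : ∀ m b τ → + 2 ℤ.* m ℤ.+ -[1+ 0 ] ℤ.* τ ≡ ℤ.- (+ 2 ℤ.* b ℤ.+ + 1 ℤ.* τ) ℤ.+ + 2 ℤ.* (m ℤ.+ b)
        parity₂ = ℤ-Solver.solve-∀
        parity₃ : ∀ m b τ → ℤ.- (+ 2 ℤ.* m ℤ.+ + 1 ℤ.* τ) ≡ ℤ.- (+ 2 ℤ.* b ℤ.+ + 1 ℤ.* τ) ℤ.+ + 2 ℤ.* (b ℤ.- m)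
        parity₃ = ℤ-Solver.solve-∀
        parity₄ : ∀ m b τ → ℤ.- (+ 2 ℤ.* m ℤ.+ -[1+ 0 ] ℤ.* τ)
                            ≡ ℤ.- (+ 2 ℤ.* b ℤ.+ + 1 ℤ.* τ) ℤ.+ + 2 ℤ.* (b ℤ.- m ℤ.+ τ)
        parity₄ = ℤ-Solver.solve-∀
        by-cases : n ≡ + 1 ⊎ n ≡ -[1+ 0 ] → + 0 ℤ.≤ T ⊎ T ℤ.≤ + 0 → F oneOK (m , n) ≡ F oneOK (b , + 1)
        by-cases (inj₁ refl) (inj₁ T≥0) = F-window b m n (m ℤ.+ b ℤ.+ τ) isFloor refl
          (subst (InWindow Mℤ) (parity₁ m b τ) (proj₁ (window refl) T≥0)) (cong (λ z → z ℤ.* z) (sym (parity₁ m b τ)))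
        by-cases (inj₂ refl) (inj₁ T≥0) = F-window b m n (m ℤ.+ b) isFloor refl
          (subst (InWindow Mℤ) (parity₂ m b τ) (proj₁ (window refl) T≥0)) (cong (λ z → z ℤ.* z) (sym (parity₂ m b τ)))
        by-cases (inj₁ refl) (inj₂ T≤0) = F-window b m n (b ℤ.- m) isFloor refl
          (subst (InWindow Mℤ) (parity₃ m b τ) (proj₂ (window refl) T≤0))
          (trans (cong (λ z → z ℤ.* z) (sym (parity₃ m b τ))) (neg² T))
        by-cases (inj₂ refl) (inj₂ T≤0) = F-window b m n (b ℤ.- m ℤ.+ τ) isFloor refl
          (subst (InWindow Mℤ) (parity₄ m b τ) (proj₂ (window refl) T≤0))
          (trans (cong (λ z → z ℤ.* z) (sym (parity₄ m b τ))) (neg² T))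

    combine-N⁺-Tr : ∀ b i j → let y = emb (b , + 1) in
                    ι i * (ι (+ 4) * N⁺ y) + ι j * Tr y ≡ ι (i ℤ.* Xℤ b (+ 1) ℤ.+ j ℤ.* Trℤ b (+ 1))
    combine-N⁺-Tr b i j = begin
        ι i * (ι (+ 4) * N⁺ y) + ι j * Tr y   ≡⟨ cong₂ (λ a c → ι i * a + ι j * c) (4N⁺-emb b (+ 1) refl) (Tr-emb b (+ 1)) ⟩
        ι i * ι X + ι j * ι T                 ≡⟨ cong₂ _+_ (sym (ι-* i X)) (sym (ι-* j T)) ⟩
        ι (i ℤ.* X) + ι (j ℤ.* T)             ≡⟨ sym (ι-+ (i ℤ.* X) (j ℤ.* T)) ⟩
        ι (i ℤ.* X ℤ.+ j ℤ.* T)               ∎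
      where
        open ≡-Reasoning
        y = emb (b , + 1)
        T = Trℤ b (+ 1)
        X = Xℤ b (+ 1)

    floor⇒small-cosine : ∀ b → IsFloorβ b → let y = emb (b , + 1) in
                         Tr y < 0ℚ × 0ℚ ≤ N⁺ y + N⁺ y - Tr y × 0ℚ ≤ - Tr y - (N⁺ y + N⁺ y)
    floor⇒small-cosine b isFloor = t<0 , lower , upper
      where
        y = emb (b , + 1)
        T = Trℤ b (+ 1)
        X = Xℤ b (+ 1)
        window = floor⇒window b isFloor
        2≤M : + 2 ℤ.≤ Mℤ
        2≤M = ℤP.+-monoˡ-≤ (ℤ.- + 3) 5≤Δ
        u₀≥1 = window-lower Mℤ (u₀ b) 2≤M (proj₁ window) (proj₂ window)
        t<0 : Tr y < 0ℚ
        t<0 = subst (_< 0ℚ) (sym (Tr-emb b (+ 1)))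
                (ι-mono-< (0≤j-i-1⇒i<j {T} {+ 0} (subst (+ 0 ℤ.≤_) (shift T) (proj₁ u₀≥1))))
          where shift : ∀ T → ℤ.- T ℤ.- + 1 ≡ + 0 ℤ.- T ℤ.- + 1
                shift = ℤ-Solver.solve-∀
        half-of-nonNeg : ∀ {p} i → p ≡ ι i * ½ → + 0 ℤ.≤ i → 0ℚ ≤ p
        half-of-nonNeg i p≡ i≥0 = subst (0ℚ ≤_) (sym p≡)
                                    (nonNeg*nonNeg≥0 (ι-mono-≤ i≥0) (ℚP.<⇒≤ (ℚP.positive⁻¹ ½)))
        lower-form : ∀ Q t → Q + Q - t ≡ (ι (+ 1) * (ι (+ 4) * Q) + ι -[1+ 1 ] * t) * ½
        lower-form = RS.solve-∀ ℚ-ring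
        upper-form : ∀ Q t → - t - (Q + Q) ≡ (ι -[1+ 0 ] * (ι (+ 4) * Q) + ι -[1+ 1 ] * t) * ½
        upper-form = RS.solve-∀ ℚ-ring
        lower-int : ∀ T d → + 1 ℤ.* (T ℤ.* T ℤ.- d ℤ.+ + 4) ℤ.+ -[1+ 1 ] ℤ.* T
                            ≡ (ℤ.- T ℤ.+ + 1) ℤ.* (ℤ.- T ℤ.+ + 1) ℤ.- (d ℤ.- + 3)
        lower-int = ℤ-Solver.solve-∀
        upper-int : ∀ T d → -[1+ 0 ] ℤ.* (T ℤ.* T ℤ.- d ℤ.+ + 4) ℤ.+ -[1+ 1 ] ℤ.* T
                            ≡ ((d ℤ.- + 3) ℤ.- (ℤ.- T ℤ.- + 1) ℤ.* (ℤ.- T ℤ.- + 1) ℤ.- + 1) ℤ.+ + 1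
        upper-int = ℤ-Solver.solve-∀
        lower : 0ℚ ≤ N⁺ y + N⁺ y - Tr y
        lower = half-of-nonNeg _ (trans (lower-form (N⁺ y) (Tr y)) (cong (_* ½) (trans (combine-N⁺-Tr b (+ 1) -[1+ 1 ]) (cong ι (lower-int T Δ)))))
                  (ℤP.i≤j⇒0≤j-i (proj₂ (proj₁ window)))
        upper : 0ℚ ≤ - Tr y - (N⁺ y + N⁺ y)
        upper = half-of-nonNeg _ (trans (upper-form (N⁺ y) (Tr y)) (cong (_* ½) (trans (combine-N⁺-Tr b -[1+ 0 ] -[1+ 1 ]) (cong ι (upper-int T Δ)))))
                  (0≤i+j (proj₂ u₀≥1) (0≤+ 1))

    good-b+ω : ∀ b → IsFloorβ b → Good oneOK (b , + 1)
    good-b+ω b isFloor = inj₁ (det b) , s , subst (λ z → MinimalWith s z (emb (b , + 1))) (sym emb-oneOK) minimal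
      where
        det : ∀ b → + 1 ℤ.* + 1 ℤ.- + 0 ℤ.* b ≡ + 1
        det = ℤ-Solver.solve-∀
        small = floor⇒small-cosine b isFloor
        s-minimal = small-cosine⇒minimal (emb (b , + 1)) (proj₁ small) (proj₁ (proj₂ small)) (proj₂ (proj₂ small))
        s = proj₁ s-minimal
        minimal = proj₂ s-minimal

  minimal⇒cosine : ∀ s y → MinimalWith s (emb oneOK) y →
                   inner·α² s (emb oneOK) y ⊗ fromℚ (Tr y) ≡ normSq·α² s (emb oneOK) ⊗ fromℚ (N⁺ y)
  minimal⇒cosine s y (_ , equal-norms , _) =
    subst (λ z → normSq·α² s z ≡ normSq·α² s y → inner·α² s z y ⊗ fromℚ (Tr y) ≡ normSq·α² s z ⊗ fromℚ (N⁺ y))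
          (sym emb-oneOK) (inner·Tr≡normSq·N⁺ s y) equal-norms

  private
    quarter : ∀ q → q ≡ (ι (+ 4) * q) * (+ 1 / 4)
    quarter = RS.solve-∀ ℚ-ring

  cosine-1mod4 : 1 ℕ.< D → D ℕ.% 4 ≡ 1 → ∀ b s → MinimalWith s (emb oneOK) (emb (b , + 1)) →
    inner·α² s (emb oneOK) (emb (b , + 1)) ⊗ fromℚ ((+ 2 ℤ.* b ℤ.+ + 1) / 1)
      ≡ normSq·α² s (emb oneOK) ⊗ fromℚ ((b ℤ.* b ℤ.+ b) / 1 ℚ.+ (+ 5 ℤ.- + D) / 4)
  cosine-1mod4 1<D D≡1 b s minimal =
    subst₂ (λ t q → inner·α² s (emb oneOK) y ⊗ fromℚ t ≡ normSq·α² s (emb oneOK) ⊗ fromℚ q)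
           Tr≡ N⁺≡ (minimal⇒cosine s y minimal)
    where
      eq : D≡1mod4? ≡ true
      eq = cong (ℕ._≡ᵇ 1) D≡1
      open WithOmega (omegaData-1mod4 eq (1<D⇒1[mod4]⇒5≤D D 1<D eq))
      open ≡-Reasoning
      y = emb (b , + 1)
      Tr-form : ∀ b → + 2 ℤ.* b ℤ.+ + 1 ℤ.* + 1 ≡ + 2 ℤ.* b ℤ.+ + 1
      Tr-form = ℤ-Solver.solve-∀
      X-form : ∀ b d → (+ 2 ℤ.* b ℤ.+ + 1 ℤ.* + 1) ℤ.* (+ 2 ℤ.* b ℤ.+ + 1 ℤ.* + 1) ℤ.- d ℤ.+ + 4
                       ≡ + 4 ℤ.* (b ℤ.* b ℤ.+ b) ℤ.+ (+ 5 ℤ.- d)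
      X-form = ℤ-Solver.solve-∀
      distribute : ∀ a c → (ι (+ 4) * a + c) * (+ 1 / 4) ≡ a + c * (+ 1 / 4)
      distribute = RS.solve-∀ ℚ-ring
      Tr≡ : Tr y ≡ (+ 2 ℤ.* b ℤ.+ + 1) / 1
      Tr≡ = trans (Tr-emb b (+ 1)) (cong ι (Tr-form b))
      N⁺≡ : N⁺ y ≡ (b ℤ.* b ℤ.+ b) / 1 ℚ.+ (+ 5 ℤ.- + D) / 4
      N⁺≡ = begin
        N⁺ y
          ≡⟨ quarter (N⁺ y) ⟩
        (ι (+ 4) * N⁺ y) * (+ 1 / 4)
          ≡⟨ cong (_* (+ 1 / 4)) (4N⁺-emb b (+ 1) refl) ⟩
        ι (Xℤ b (+ 1)) * (+ 1 / 4)
          ≡⟨ cong (λ z → ι z * (+ 1 / 4))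
                  (trans (cong (λ d → Trℤ b (+ 1) ℤ.* Trℤ b (+ 1) ℤ.- d ℤ.+ + 4) (Δ-1mod4 eq)) (X-form b (+ D))) ⟩
        ι (+ 4 ℤ.* (b ℤ.* b ℤ.+ b) ℤ.+ (+ 5 ℤ.- + D)) * (+ 1 / 4)
          ≡⟨ cong (_* (+ 1 / 4)) (trans (ι-+ (+ 4 ℤ.* (b ℤ.* b ℤ.+ b)) (+ 5 ℤ.- + D))
                                        (cong (_+ ι (+ 5 ℤ.- + D)) (ι-* (+ 4) (b ℤ.* b ℤ.+ b)))) ⟩
        (ι (+ 4) * ι (b ℤ.* b ℤ.+ b) + ι (+ 5 ℤ.- + D)) * (+ 1 / 4)
          ≡⟨ distribute (ι (b ℤ.* b ℤ.+ b)) (ι (+ 5 ℤ.- + D)) ⟩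
        ι (b ℤ.* b ℤ.+ b) + ι (+ 5 ℤ.- + D) * (+ 1 / 4)
          ≡⟨ cong (λ z → ι (b ℤ.* b ℤ.+ b) + z) (sym (i/4≡ι[i]*¼ (+ 5 ℤ.- + D))) ⟩
        (b ℤ.* b ℤ.+ b) / 1 ℚ.+ (+ 5 ℤ.- + D) / 4 ∎

  ≢1⇒D≡1mod4?≡false : ¬ D ℕ.% 4 ≡ 1 → D≡1mod4? ≡ false
  ≢1⇒D≡1mod4?≡false D≢1 with D≡1mod4? in eq
  ... | true = ⊥-elim (D≢1 (ℕP.≡ᵇ⇒≡ (D ℕ.% 4) 1 (subst Bool.T (sym eq) tt)))
  ... | false = refl

  cosine-2,3mod4 : 1 ℕ.< D → ¬ D ℕ.% 4 ≡ 1 → ∀ b s → MinimalWith s (emb oneOK) (emb (b , + 1)) →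
    inner·α² s (emb oneOK) (emb (b , + 1)) ⊗ fromℚ ((+ 2 ℤ.* b) / 1)
      ≡ normSq·α² s (emb oneOK) ⊗ fromℚ ((b ℤ.* b ℤ.+ + 1 ℤ.- + D) / 1)
  cosine-2,3mod4 1<D D≢1 b s minimal =
    subst₂ (λ t q → inner·α² s (emb oneOK) y ⊗ fromℚ t ≡ normSq·α² s (emb oneOK) ⊗ fromℚ q)
           Tr≡ N⁺≡ (minimal⇒cosine s y minimal)
    where
      eq = ≢1⇒D≡1mod4?≡false D≢1
      open WithOmega (omegaData-2,3mod4 eq 1<D)
      open ≡-Reasoning
      y = emb (b , + 1)
      Tr-form : ∀ b → + 2 ℤ.* b ℤ.+ + 1 ℤ.* + 0 ≡ + 2 ℤ.* b
      Tr-form = ℤ-Solver.solve-∀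
      X-form : ∀ b d → (+ 2 ℤ.* b ℤ.+ + 1 ℤ.* + 0) ℤ.* (+ 2 ℤ.* b ℤ.+ + 1 ℤ.* + 0) ℤ.- + 4 ℤ.* d ℤ.+ + 4
                       ≡ + 4 ℤ.* (b ℤ.* b ℤ.+ + 1 ℤ.- d)
      X-form = ℤ-Solver.solve-∀
      cancel : ∀ a → (ι (+ 4) * a) * (+ 1 / 4) ≡ a
      cancel = RS.solve-∀ ℚ-ring
      Tr≡ : Tr y ≡ (+ 2 ℤ.* b) / 1
      Tr≡ = trans (Tr-emb b (+ 1)) (cong ι (Tr-form b))
      N⁺≡ : N⁺ y ≡ (b ℤ.* b ℤ.+ + 1 ℤ.- + D) / 1
      N⁺≡ = begin
        N⁺ y
          ≡⟨ quarter (N⁺ y) ⟩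
        (ι (+ 4) * N⁺ y) * (+ 1 / 4)
          ≡⟨ cong (_* (+ 1 / 4)) (4N⁺-emb b (+ 1) refl) ⟩
        ι (Xℤ b (+ 1)) * (+ 1 / 4)
          ≡⟨ cong (λ z → ι z * (+ 1 / 4))
                  (trans (cong (λ d → Trℤ b (+ 1) ℤ.* Trℤ b (+ 1) ℤ.- d ℤ.+ + 4)
                               (trans (Δ-2,3mod4 eq) (ℤP.pos-* 4 D)))
                         (X-form b (+ D))) ⟩
        ι (+ 4 ℤ.* (b ℤ.* b ℤ.+ + 1 ℤ.- + D)) * (+ 1 / 4)
          ≡⟨ cong (_* (+ 1 / 4)) (ι-* (+ 4) (b ℤ.* b ℤ.+ + 1 ℤ.- + D)) ⟩
        (ι (+ 4) * ι (b ℤ.* b ℤ.+ + 1 ℤ.- + D)) * (+ 1 / 4)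
          ≡⟨ cancel _ ⟩
        (b ℤ.* b ℤ.+ + 1 ℤ.- + D) / 1 ∎

corollary4p3 : (D : ℕ) → 1 ℕ.< D → SquareFree D →
    let open QuadField D in
    (b : ℤ) → IsFloorβ b →
      Good oneOK (b , + 1)
      × (∀ (y : OK) → Good oneOK y → F oneOK y ≡ F oneOK (b , + 1))
      × (∀ (s : K) → MinimalWith s (emb oneOK) (emb (b , + 1)) →
           (D ℕ.% 4 ≡ 1 →
              inner·α² s (emb oneOK) (emb (b , + 1)) ⊗ fromℚ ((+ 2 ℤ.* b ℤ.+ + 1) / 1)
                ≡ normSq·α² s (emb oneOK)
                  ⊗ fromℚ ((b ℤ.* b ℤ.+ b) / 1 ℚ.+ (+ 5 ℤ.- + D) / 4))
           × (¬ (D ℕ.% 4 ≡ 1) →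
              inner·α² s (emb oneOK) (emb (b , + 1)) ⊗ fromℚ ((+ 2 ℤ.* b) / 1)
                ≡ normSq·α² s (emb oneOK)
                  ⊗ fromℚ ((b ℤ.* b ℤ.+ + 1 ℤ.- + D) / 1)))
corollary4p3 D 1<D _ b isFloor =
    good-b+ω b isFloor
  , F-unique b isFloor
  , λ s minimal → (λ D≡1 → cosine-1mod4 1<D D≡1 b s minimal) , (λ D≢1 → cosine-2,3mod4 1<D D≢1 b s minimal)
  where
    open RealQuadratic D
    open WithOmega (omegaData 1<D)
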